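{- Let $\mathrm{M}$ be a matroid of rank $r$ and let $m$ be a standard monomial of $\underline{A}^{\bullet}(\mathrm{M})$ with a set of essential flats $\mathcal{G}_m$. Then (1) $\deg(m \cdot \prod_{\emptyset \neq G \in \mathcal{G}_m} x_G) = 1$; (2) for each standard monomial $m'$ of $\underline{A}^{\bullet}(\mathrm{M})$ with $\deg(m' \cdot \prod_{\emptyset \neq G \in \mathcal{G}_m} x_G) \neq 0$, either $m = m'$ or $\delta(m') > \delta(m)$ in the lexicographic order.
   Context: A matroid $\mathrm{M}$ is a finite nonempty atomic ranked lattice $\mathcal{L}_{\mathrm{M}}$ (every element is the join of the atoms below it; every maximal chain in $[\emptyset, F]$ has length $\operatorname{rk}(F)$) whose rank function $\operatorname{rk}$ is submodular; minimal flat $\emptyset$, maximal $E$, $r = \operatorname{rk}(E)$. Let $\overline{\mathcal{L}}_{\mathrm{M}} = \mathcal{L}_{\mathrm{M}} \setminus \{\emptyset\}$. The Chow ring $\underline{A}^{\bullet}(\mathrm{M})$ is the quotient of $\mathbb{Z}[h_F]_{F \in \overline{\mathcal{L}}_{\mathrm{M}}}$ by $((h_{F} - h_{G \vee F})(h_G - h_{G \vee F}) : F, G \in \overline{\mathcal{L}}_{\mathrm{M}}) + (h_a : a \text{ atom})$, graded with $h_F$ in degree $1$. A standard monomial of $\underline{A}^{\bullet}(\mathrm{M})$ is $h_{F_{i_1}}^{a_1} \dotsb h_{F_{i_k}}^{a_k}$ with $\emptyset = F_{i_0} < F_{i_1} < \dotsb < F_{i_k}$, all $a_j \ge 1$, and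 $a_j < \operatorname{rk}(F_{i_j}) - \operatorname{rk}(F_{i_{j-1}})$ for $j \ge 1$. For such $m$, $\delta(m) = (\sum_{\operatorname{rk}(F_{i_j}) \le 1} a_j, \sum_{\operatorname{rk}(F_{i_j}) \le 2} a_j, \dotsc, \sum_{\operatorname{rk}(F_{i_j}) \le r} a_j)$. Essential flats: extend $F_{i_1} < \dotsb < F_{i_k}$ to a maximal chain $\emptyset = F_0 < F_1 < \dotsb < F_r = E$; $\mathcal{G}_m$ is obtained from this chain by removing, for each $j$, the $a_j$ flats immediately below $F_{i_j}$, and removing $E$ (so $\emptyset \in \mathcal{G}_m$). The degree map $\deg \colon \underline{A}^{r-1}(\mathrm{M}) \to \mathbb{Z}$ is the isomorphism with $\deg(h_{F_1}\dotsb h_{F_{r-1}}) = 1$ if $\operatorname{rk}(\bigvee_{i\in T}F_i) \ge |T|+1$ for all nonempty $T \subseteq [r-1]$ and $0$ otherwise, extended by zero to other degrees. For a flat $G \neq \emptyset, E$, with $\mathcal{A}$ the set of atoms not below $G$, $x_G = -\sum_{S \subseteq \mathcal{A}} (-1)^{|S|} h_{G \vee \bigvee_{a \in S} a} \in \underline{A}^1(\mathrm{M})$. -}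

module Defs where

open import Level using (0ℓ)
open import Data.Nat as ℕ using (ℕ; zero; suc; _∸_)
import Data.Nat.Properties as ℕP
open import Data.Integer as ℤ using (ℤ; 0ℤ; 1ℤ; -_)
open import Data.Fin as Fin using (Fin; toℕ; fromℕ; inject₁)
import Data.Fin.Properties as FinP
open import Data.List using (List; []; _∷_; _++_; map; concatMap; foldr; filter; length; replicate; allFin; upTo)
open import Data.List.Relation.Unary.All as All using (All)
open import Data.List.Relation.Unary.Any as Any using (Any)
open import Data.Product using (Σ; _×_; _,_; ∃)
open import Data.Product.Properties using () renaming (≡-dec to ×-≡-dec)
open import Data.Sum using (_⊎_)
open import Data.Bool using (Bool; true; false; if_then_else_) renaming (_∧_ to _and_)
open import Relation.Nullary using (¬_; Dec; yes; no; ¬?; _×-dec_; _⊎-dec_; ⌊_⌋)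
open import Relation.Binary using (Rel; Decidable)
open import Relation.Binary.PropositionalEquality using (_≡_; _≢_)
open import Relation.Binary.Lattice.Structures using (IsBoundedLattice)

module _ {A : Set} (_≤_ : Rel A 0ℓ) where

  Strict : A → A → Set
  Strict a b = (a ≤ b) × (a ≢ b)

  Covers : A → A → Set
  Covers a b = Strict a b × (∀ c → ¬ (Strict a c × Strict c b))

  data SatChain : A → A → ℕ → Set where
    done : ∀ {a} → SatChain a a 0
    step : ∀ {a b c k} → Covers a b → SatChain b c k → SatChain a c (suc k)

-- A matroid as a finite atomic ranked lattice with submodular rank.
-- The flats are the elements of Fin n; ⊥ is the flat ∅, ⊤ is the flat E.

record Matroid : Set₁ where
  field
    n   : ℕ
    _≤_ : Rel (Fin n) 0ℓ
    _≤?_ : Decidable _≤_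
    _∨_ : Fin n → Fin n → Fin n
    _∧_ : Fin n → Fin n → Fin n
    ⊤   : Fin n
    ⊥   : Fin n
    isBoundedLattice : IsBoundedLattice _≡_ _≤_ _∨_ _∧_ ⊤ ⊥
    rk  : Fin n → ℕ
    ranked : ∀ F k → SatChain _≤_ ⊥ F k → k ≡ rk F
    -- atomic: every F is the join (least upper bound) of the atoms below it
    atomic : ∀ F G → (∀ a → Covers _≤_ ⊥ a → a ≤ F → a ≤ G) → F ≤ G
    submodular : ∀ F G → rk (F ∨ G) ℕ.+ rk (F ∧ G) ℕ.≤ rk F ℕ.+ rk G

sublists : {A : Set} → List A → List (List A)
sublists []       = [] ∷ []
sublists (x ∷ xs) = let s = sublists xs in map (x ∷_) s ++ s

negOnePow : ℕ → ℤ
negOnePow zero    = 1ℤ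
negOnePow (suc k) = - negOnePow k

sumℕ : List ℕ → ℕ
sumℕ = foldr ℕ._+_ 0

sumℤ : List ℤ → ℤ
sumℤ = foldr ℤ._+_ 0ℤ

module MatroidDefs (M : Matroid) where
  open Matroid M public

  r : ℕ
  r = rk ⊤

  _<_ : Fin n → Fin n → Set
  _<_ = Strict _≤_

  _≟_ : (a b : Fin n) → Dec (a ≡ b)
  _≟_ = FinP._≟_

  _<?_ : Decidable _<_
  a <? b = (a ≤? b) ×-dec ¬? (a ≟ b)

  Atom : Fin n → Set
  Atom a = Covers _≤_ ⊥ a

  atom? : (a : Fin n) → Dec (Atom a)
  atom? a = (⊥ <? a) ×-dec FinP.all? (λ c → ¬? ((⊥ <? c) ×-dec (c <? a)))

  joinL : List (Fin n) → Fin n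
  joinL = foldr _∨_ ⊥

  -- Polynomials in ℤ[h_F]_{F ≠ ∅}: formal ℤ-linear combinations of
  -- monomials; a monomial is a list of flats F₁ ⋯ F_k (meaning h_{F₁}⋯h_{F_k}).

  Monomial : Set
  Monomial = List (Fin n)

  Poly : Set
  Poly = List (ℤ × Monomial)

  one : Poly
  one = (1ℤ , []) ∷ []

  _*P_ : Poly → Poly → Poly
  p *P q = concatMap (λ { (c , u) → map (λ { (d , v) → (c ℤ.* d , u ++ v) }) q }) p

  prodP : List Poly → Poly
  prodP = foldr _*P_ one

  degCondition : Monomial → Bool
  degCondition u =
    ⌊ All.all? (λ T → (length T ℕ.≟ 0) ⊎-dec (suc (length T) ℕ.≤? rk (joinL T)))
               (sublists u) ⌋

  degMono : Monomial → ℤ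
  degMono u = if ⌊ suc (length u) ℕ.≟ r ⌋ and degCondition u then 1ℤ else 0ℤ

  deg : Poly → ℤ
  deg p = sumℤ (map (λ { (c , u) → c ℤ.* degMono u }) p)

  -- x_G = - Σ_{S ⊆ 𝒜} (-1)^{|S|} h_{G ∨ ⋁ S}, 𝒜 = atoms not below G

  atomsNotBelow : Fin n → List (Fin n)
  atomsNotBelow G = filter (λ a → atom? a ×-dec ¬? (a ≤? G)) (allFin n)

  x : Fin n → Poly
  x G = map (λ S → (- negOnePow (length S) , (G ∨ joinL S) ∷ [])) (sublists (atomsNotBelow G))

  -- Standard monomials h_{F₁}^{a₁}⋯h_{F_k}^{a_k}, represented by the list
  -- of pairs (F_j , a_j).

  SMono : Set
  SMono = List (Fin n × ℕ)

  data ChainFrom : Fin n → SMono → Set where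
    []  : ∀ {F} → ChainFrom F []
    _∷_ : ∀ {F G a m} →
          (F < G) × (1 ℕ.≤ a) × (a ℕ.< rk G ∸ rk F) →
          ChainFrom G m → ChainFrom F ((G , a) ∷ m)

  Standard : SMono → Set
  Standard m = ChainFrom ⊥ m

  toPoly : SMono → Poly
  toPoly m = (1ℤ , concatMap (λ { (F , a) → replicate a F }) m) ∷ []

  δ : SMono → List ℕ
  δ m = map (λ k → sumℕ (map (λ { (F , a) → if ⌊ rk F ℕ.≤? k ⌋ then a else 0 }) m))
            (map suc (upTo r))

  MaxChain : (Fin (suc r) → Fin n) → Set
  MaxChain c = (c Fin.zero ≡ ⊥) × (c (fromℕ r) ≡ ⊤)
             × (∀ (i : Fin r) → Covers _≤_ (c (inject₁ i)) (c (Fin.suc i)))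

  Extends : (Fin (suc r) → Fin n) → SMono → Set
  Extends c m = All (λ { (F , a) → ∃ λ i → c i ≡ F }) m

  -- position i of the chain (c i has rank i) is removed because of (F_j , a_j)
  -- iff it is one of the a_j positions immediately below F_j, i.e.
  -- rk F_j - a_j ≤ i < rk F_j.
  removed? : (m : SMono) → (i : ℕ) → Dec (Any (λ { (F , a) → (rk F ∸ a ℕ.≤ i) × (i ℕ.< rk F) }) m)
  removed? m i = Any.any? (λ { (F , a) → (rk F ∸ a ℕ.≤? i) ×-dec (i ℕ.<? rk F) }) m


  -- the nonempty essential flats: 𝒢_m minus ∅ (E is removed as well)
  essentialNonempty : SMono → (Fin (suc r) → Fin n) → List (Fin n)
  essentialNonempty m c =
    map c (filter (λ i → ¬? (removed? m (toℕ i)) ×-dec (¬? (c i ≟ ⊤) ×-dec ¬? (c i ≟ ⊥)))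
                  (allFin (suc r)))

  xProd : SMono → (Fin (suc r) → Fin n) → Poly
  xProd m c = prodP (map x (essentialNonempty m c))

{-# OPTIONS --safe #-}
-- For flats B < G, ideg B G u is the degree of the monomial u in the interval [B, G]:
-- it is 1 exactly when u has rk G − rk B − 1 factors and rk B + #{factors below X}
-- < rk (B ∨ X) for every flat X above some factor; ideg ∅ E is the degree map.
--
-- Multiplying by x_G splits this degree along G: for B < G < E,
--   deg[B,E] (x_G · u) = deg[B,G] (factors of u below G) · deg[G,E] (the other factors).
-- Expanding x_G gives an alternating sum over the sets S of atoms not below G. By
-- submodularity the flats X ⊒ G at which u is tight (rk X ≤ rk B + #{factors below X} + 1)
-- are closed under joins; if there is one, the term for S is 1 − [S ⊆ K] for the
-- greatest tight flat K, so the sum is [K = G], which is the product of the two interval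
-- degrees. Otherwise all terms are equal and cancel.
--
-- Iterating along the essential flats ∅ < G₁ < ⋯ < G_k < E of m turns deg (m′ · ∏ x_G)
-- into a product of interval degrees. Only removed positions lie strictly between
-- consecutive essential flats, so the factors of m in (G_{i-1}, G_i] are the copies of
-- G_i and fill the interval exactly: this gives (1). If the product is nonzero for m′,
-- the size condition of each interval says that m′ has as many factors below every flat
-- of m as m has; hence m′ has at least as many factors of rank ≤ k as m for every k,
-- which is δ(m) ≤ δ(m′) pointwise, and equality forces m′ = m.
module Submission where

open import Defs
open import Level using (0ℓ)
open import Function using (_∘_; case_of_)
open import Function.Bundles using (_⇔_; mk⇔; Equivalence)
open import Data.Empty using (⊥-elim)
open import Data.Bool using (if_then_else_) renaming (_∧_ to _and_)
open import Data.Product using (_×_; _,_; ∃; ∃-syntax; proj₁; proj₂)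
import Data.Product as Product
open import Data.Sum using (_⊎_; inj₁; inj₂)
open import Data.Nat using (ℕ; zero; suc; _+_; _∸_; _≤_; _<_; z≤n; s≤s)
import Data.Nat as ℕ
import Data.Nat.Properties as ℕP
open import Data.Nat.Induction using (<-wellFounded)
open import Induction.WellFounded using (Acc; acc)
open import Data.Integer using (ℤ; 0ℤ; 1ℤ; -_) renaming (_+_ to _+ℤ_; _*_ to _*ℤ_)
import Data.Integer as ℤ
import Data.Integer.Properties as ℤP
open import Algebra.Properties.CommutativeSemigroup ℤP.+-commutativeSemigroup
  using () renaming (interchange to +-interchange)
open import Algebra.Properties.CommutativeSemigroup ℤP.*-commutativeSemigroup
  using () renaming (x∙yz≈y∙xz to *-leftComm)
open import Data.Fin using (Fin; toℕ)
import Data.Fin as Fin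
import Data.Fin.Properties as FinP
open import Data.List using (List; []; _∷_; _++_; map; filter; length; allFin; replicate; upTo; foldr; concatMap)
import Data.List.Properties as ListP
open import Data.List.Membership.Propositional using (_∈_)
import Data.List.Membership.Propositional.Properties as ∈P
open import Data.List.Relation.Unary.All as All using (All; []; _∷_)
import Data.List.Relation.Unary.All.Properties as AllP
open import Data.List.Relation.Unary.Any as Any using (Any; here; there)
import Data.List.Relation.Unary.Any.Properties as AnyP
open import Data.List.Relation.Unary.AllPairs using (AllPairs; []; _∷_)
import Data.List.Relation.Unary.AllPairs.Properties as AllPairsP
open import Data.List.Relation.Binary.Lex.Strict using (Lex-<)
import Data.List.Relation.Binary.Lex.Core as Lex
open import Data.List.Relation.Binary.Permutation.Propositional using (_↭_; ↭-sym)
open import Data.List.Relation.Binary.Permutation.Propositional.Properties using (↭-length; filter-↭; shifts)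
open import Relation.Nullary using (¬_; Dec; yes; no; does; ¬?; _×-dec_; _⊎-dec_; _→-dec_; ⌊_⌋)
open import Relation.Unary using (Pred; Decidable)
open import Relation.Binary.Definitions using (tri<; tri≈; tri>)
open import Relation.Binary.PropositionalEquality
  using (_≡_; _≢_; refl; sym; trans; cong; cong₂; subst; subst₂; module ≡-Reasoning)
open import Relation.Binary.Lattice.Structures using (IsBoundedLattice)
open import Relation.Binary.Lattice.Bundles using (BoundedLattice)
import Relation.Binary.Lattice.Properties.JoinSemilattice as JoinSemilatticeProperties
import Relation.Binary.Lattice.Properties.BoundedJoinSemilattice as BoundedJoinSemilatticeProperties

module _ {A : Set} {P Q : Pred A 0ℓ} (P? : Decidable P) (Q? : Decidable Q) where

  length-filter-mono : ∀ xs → (∀ {x} → x ∈ xs → P x → Q x) → length (filter P? xs) ≤ length (filter Q? xs)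
  length-filter-mono []       P⇒Q = z≤n
  length-filter-mono (x ∷ xs) P⇒Q with P? x | Q? x
  ... | yes _ | yes _ = s≤s (length-filter-mono xs (P⇒Q ∘ there))
  ... | yes p | no ¬q = ⊥-elim (¬q (P⇒Q (here refl) p))
  ... | no _  | yes _ = ℕP.m≤n⇒m≤1+n (length-filter-mono xs (P⇒Q ∘ there))
  ... | no _  | no _  = length-filter-mono xs (P⇒Q ∘ there)

  length-filter-< : (∀ {x} → P x → Q x) → ∀ {y} xs → y ∈ xs → ¬ P y → Q y →
                    length (filter P? xs) < length (filter Q? xs)
  length-filter-< P⇒Q (x ∷ xs) (here refl) ¬py qy with P? x | Q? x
  ... | yes py | _     = ⊥-elim (¬py py)
  ... | no _   | no ¬q = ⊥-elim (¬q qy)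
  ... | no _   | yes _ = s≤s (length-filter-mono xs (λ _ → P⇒Q))
  length-filter-< P⇒Q (x ∷ xs) (there y∈) ¬py qy with P? x | Q? x
  ... | yes _ | yes _ = s≤s (length-filter-< P⇒Q xs y∈ ¬py qy)
  ... | yes p | no ¬q = ⊥-elim (¬q (P⇒Q p))
  ... | no _  | yes _ = ℕP.m≤n⇒m≤1+n (length-filter-< P⇒Q xs y∈ ¬py qy)
  ... | no _  | no _  = length-filter-< P⇒Q xs y∈ ¬py qy

  filter-filter-⇒ : (∀ {x} → P x → Q x) → ∀ xs → filter P? (filter Q? xs) ≡ filter P? xs
  filter-filter-⇒ P⇒Q [] = refl
  filter-filter-⇒ P⇒Q (x ∷ xs) with Q? x
  ... | no ¬q = trans (filter-filter-⇒ P⇒Q xs) (sym (ListP.filter-reject P? (¬q ∘ P⇒Q)))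
  ... | yes _ with P? x
  ...   | yes _ = cong (x ∷_) (filter-filter-⇒ P⇒Q xs)
  ...   | no _  = filter-filter-⇒ P⇒Q xs

  length-filter-partition : ∀ xs → length (filter P? xs) ≡
    length (filter P? (filter Q? xs)) + length (filter P? (filter (¬? ∘ Q?) xs))
  length-filter-partition [] = refl
  length-filter-partition (x ∷ xs) with Q? x
  ... | yes _ with P? x
  ...   | yes _ = cong suc (length-filter-partition xs)
  ...   | no _  = length-filter-partition xs
  length-filter-partition (x ∷ xs) | no _ with P? x
  ...   | yes _ = trans (cong suc (length-filter-partition xs)) (sym (ℕP.+-suc _ _))
  ...   | no _  = length-filter-partition xs

module _ {A : Set} {P : Pred A 0ℓ} (P? : Decidable P) where

  length-partition : ∀ xs → length xs ≡ length (filter P? xs) + length (filter (¬? ∘ P?) xs)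
  length-partition []       = refl
  length-partition (x ∷ xs) with P? x
  ... | yes _ = cong suc (length-partition xs)
  ... | no _  = trans (cong suc (length-partition xs)) (sym (ℕP.+-suc _ _))

  length-filter-++ : ∀ xs ys → length (filter P? (xs ++ ys)) ≡ length (filter P? xs) + length (filter P? ys)
  length-filter-++ xs ys = trans (cong length (ListP.filter-++ P? xs ys)) (ListP.length-++ (filter P? xs))

  length-filter-replicate : ∀ {x} a → P x → length (filter P? (replicate a x)) ≡ a
  length-filter-replicate a px = trans (cong length (ListP.filter-all P? (AllP.replicate⁺ a px))) (ListP.length-replicate a)

  length-filter-replicate-¬ : ∀ {x} a → ¬ P x → length (filter P? (replicate a x)) ≡ 0
  length-filter-replicate-¬ a ¬px = cong length (ListP.filter-none P? (AllP.replicate⁺ a ¬px))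

  ∃∈-filter : ∀ xs → 0 < length (filter P? xs) → ∃[ x ] x ∈ xs × P x
  ∃∈-filter xs 0<len with filter P? xs in eq
  ... | y ∷ _ = y , ∈P.∈-filter⁻ P? (subst (y ∈_) (sym eq) (here refl))

  filter∈sublists : ∀ xs → filter P? xs ∈ sublists xs
  filter∈sublists []       = here refl
  filter∈sublists (x ∷ xs) with P? x
  ... | yes _ = ∈P.∈-++⁺ˡ (∈P.∈-map⁺ (x ∷_) (filter∈sublists xs))
  ... | no _  = ∈P.∈-++⁺ʳ (map (x ∷_) (sublists xs)) (filter∈sublists xs)

  length-filter-sublists : ∀ xs {S} → S ∈ sublists xs → length (filter P? S) ≤ length (filter P? xs)
  length-filter-sublists []       (here refl) = z≤n
  length-filter-sublists (x ∷ xs) S∈ with ∈P.∈-++⁻ (map (x ∷_) (sublists xs)) S∈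
  ... | inj₁ S∈ₓ with ∈P.∈-map⁻ (x ∷_) S∈ₓ
  ...   | S , S∈ₛ , refl with P? x
  ...     | yes _ = s≤s (length-filter-sublists xs S∈ₛ)
  ...     | no _  = length-filter-sublists xs S∈ₛ
  length-filter-sublists (x ∷ xs) S∈ | inj₂ S∈ₛ with P? x
  ...     | yes _ = ℕP.m≤n⇒m≤1+n (length-filter-sublists xs S∈ₛ)
  ...     | no _  = length-filter-sublists xs S∈ₛ

∑ : {A : Set} → (A → ℤ) → List A → ℤ
∑ f []       = 0ℤ
∑ f (x ∷ xs) = f x +ℤ ∑ f xs

module _ {A : Set} where

  ∑-++ : ∀ (f : A → ℤ) xs ys → ∑ f (xs ++ ys) ≡ ∑ f xs +ℤ ∑ f ys
  ∑-++ f []       ys = sym (ℤP.+-identityˡ _)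
  ∑-++ f (x ∷ xs) ys = trans (cong (f x +ℤ_) (∑-++ f xs ys)) (sym (ℤP.+-assoc (f x) _ _))

  ∑-map : ∀ {B : Set} (f : A → ℤ) (g : B → A) xs → ∑ f (map g xs) ≡ ∑ (f ∘ g) xs
  ∑-map f g []       = refl
  ∑-map f g (x ∷ xs) = cong (f (g x) +ℤ_) (∑-map f g xs)

  ∑-cong : ∀ {f g : A → ℤ} xs → (∀ {x} → x ∈ xs → f x ≡ g x) → ∑ f xs ≡ ∑ g xs
  ∑-cong []       f≗g = refl
  ∑-cong (x ∷ xs) f≗g = cong₂ _+ℤ_ (f≗g (here refl)) (∑-cong xs (f≗g ∘ there))

  ∑-zero : ∀ xs → ∑ (λ (_ : A) → 0ℤ) xs ≡ 0ℤ
  ∑-zero []       = refl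
  ∑-zero (x ∷ xs) = trans (ℤP.+-identityˡ _) (∑-zero xs)

  ∑-neg : ∀ (f : A → ℤ) xs → ∑ (λ x → - f x) xs ≡ - ∑ f xs
  ∑-neg f []       = refl
  ∑-neg f (x ∷ xs) = trans (cong (- f x +ℤ_) (∑-neg f xs)) (sym (ℤP.neg-distrib-+ (f x) _))

  ∑-+ : ∀ (f g : A → ℤ) xs → ∑ (λ x → f x +ℤ g x) xs ≡ ∑ f xs +ℤ ∑ g xs
  ∑-+ f g []       = refl
  ∑-+ f g (x ∷ xs) = trans (cong (f x +ℤ g x +ℤ_) (∑-+ f g xs)) (+-interchange (f x) (g x) _ _)

  ∑-scale : ∀ c (f : A → ℤ) xs → ∑ (λ x → c *ℤ f x) xs ≡ c *ℤ ∑ f xs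
  ∑-scale c f []       = sym (ℤP.*-zeroʳ c)
  ∑-scale c f (x ∷ xs) = trans (cong (c *ℤ f x +ℤ_) (∑-scale c f xs)) (sym (ℤP.*-distribˡ-+ c (f x) _))

does-⇔ : {P Q : Set} (p : Dec P) (q : Dec Q) → (P → Q) → (Q → P) → does p ≡ does q
does-⇔ (yes _) (yes _) _   _   = refl
does-⇔ (yes p) (no ¬q) P⇒Q _   = ⊥-elim (¬q (P⇒Q p))
does-⇔ (no ¬p) (yes q) _   Q⇒P = ⊥-elim (¬p (Q⇒P q))
does-⇔ (no _)  (no _)  _   _   = refl

indicator : {P : Set} → Dec P → ℤ
indicator d = if does d then 1ℤ else 0ℤ

indicator-⇔ : {P Q : Set} (p : Dec P) (q : Dec Q) → (P → Q) → (Q → P) → indicator p ≡ indicator q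
indicator-⇔ p q P⇒Q Q⇒P = cong (if_then 1ℤ else 0ℤ) (does-⇔ p q P⇒Q Q⇒P)

indicator-× : {P Q : Set} (p : Dec P) (q : Dec Q) → indicator (p ×-dec q) ≡ indicator p *ℤ indicator q
indicator-× (yes _) q = sym (ℤP.*-identityˡ (indicator q))
indicator-× (no _)  q = refl

isYes-and-indicator : {P Q : Set} (p : Dec P) (q : Dec Q) →
                      (if ⌊ p ⌋ and ⌊ q ⌋ then 1ℤ else 0ℤ) ≡ indicator (p ×-dec q)
isYes-and-indicator (yes _) (yes _) = refl
isYes-and-indicator (yes _) (no _)  = refl
isYes-and-indicator (no _)  _       = refl

indicator-yes : {P : Set} (p : Dec P) → P → indicator p ≡ 1ℤ
indicator-yes (yes _) _ = refl
indicator-yes (no ¬x) x = ⊥-elim (¬x x)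

indicator-no : {P : Set} (p : Dec P) → ¬ P → indicator p ≡ 0ℤ
indicator-no (yes x) ¬x = ⊥-elim (¬x x)
indicator-no (no _)  _  = refl

indicator≢0 : {P : Set} (p : Dec P) → indicator p ≢ 0ℤ → P
indicator≢0 (yes x) _  = x
indicator≢0 (no _)  ≢0 = ⊥-elim (≢0 refl)

module _ {A : Set} where

  alternatingSum : (List A → ℤ) → List A → ℤ
  alternatingSum f xs = ∑ (λ S → negOnePow (length S) *ℤ f S) (sublists xs)

  alternatingSum-cancel : ∀ f y xs → (∀ S → f (y ∷ S) ≡ f S) → alternatingSum f (y ∷ xs) ≡ 0ℤ
  alternatingSum-cancel f y xs f-absorbs-y = begin
    ∑ g (map (y ∷_) (sublists xs) ++ sublists xs)   ≡⟨ ∑-++ g (map (y ∷_) (sublists xs)) (sublists xs) ⟩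
    ∑ g (map (y ∷_) (sublists xs)) +ℤ ∑ g (sublists xs)
      ≡⟨ cong (_+ℤ ∑ g (sublists xs)) (trans (∑-map g (y ∷_) (sublists xs)) (∑-cong (sublists xs) (λ {S} _ → flip-sign S))) ⟩
    ∑ (λ S → - g S) (sublists xs) +ℤ ∑ g (sublists xs) ≡⟨ cong (_+ℤ ∑ g (sublists xs)) (∑-neg g (sublists xs)) ⟩
    - ∑ g (sublists xs) +ℤ ∑ g (sublists xs)          ≡⟨ ℤP.+-inverseˡ (∑ g (sublists xs)) ⟩
    0ℤ ∎
    where
    open ≡-Reasoning
    g : List A → ℤ
    g S = negOnePow (length S) *ℤ f S
    flip-sign : ∀ S → g (y ∷ S) ≡ - g S
    flip-sign S = trans (cong (negOnePow (suc (length S)) *ℤ_) (f-absorbs-y S))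
                        (sym (ℤP.neg-distribˡ-* (negOnePow (length S)) (f S)))

  alternatingSum-cong : ∀ {f g} xs → (∀ S → f S ≡ g S) → alternatingSum f xs ≡ alternatingSum g xs
  alternatingSum-cong xs f≗g = ∑-cong (sublists xs) (λ {S} _ → cong (negOnePow (length S) *ℤ_) (f≗g S))

  alternatingSum-const : ∀ {f} c xs → xs ≢ [] → (∀ S → f S ≡ c) → alternatingSum f xs ≡ 0ℤ
  alternatingSum-const c []       []≢[] _   = ⊥-elim ([]≢[] refl)
  alternatingSum-const c (y ∷ xs) _     f≡c = alternatingSum-cancel _ y xs (λ S → trans (f≡c (y ∷ S)) (sym (f≡c S)))

  alternatingSum-complement : ∀ f xs → xs ≢ [] → alternatingSum (λ S → 1ℤ ℤ.- f S) xs ≡ - alternatingSum f xs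
  alternatingSum-complement f xs xs≢[] = begin
    ∑ (λ S → σ S *ℤ (1ℤ ℤ.- f S)) (sublists xs)           ≡⟨ ∑-cong (sublists xs) (λ {S} _ → distribute (σ S) (f S)) ⟩
    ∑ (λ S → σ S *ℤ 1ℤ +ℤ - (σ S *ℤ f S)) (sublists xs)   ≡⟨ ∑-+ _ _ (sublists xs) ⟩
    alternatingSum (λ _ → 1ℤ) xs +ℤ ∑ (λ S → - (σ S *ℤ f S)) (sublists xs)
      ≡⟨ cong₂ _+ℤ_ (alternatingSum-const 1ℤ xs xs≢[] (λ _ → refl)) (∑-neg _ (sublists xs)) ⟩
    0ℤ +ℤ - alternatingSum f xs                            ≡⟨ ℤP.+-identityˡ _ ⟩
    - alternatingSum f xs                                  ∎
    where
    open ≡-Reasoning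
    σ : List A → ℤ
    σ S = negOnePow (length S)
    distribute : ∀ s t → s *ℤ (1ℤ ℤ.- t) ≡ s *ℤ 1ℤ +ℤ - (s *ℤ t)
    distribute s t = trans (ℤP.*-distribˡ-+ s 1ℤ (- t)) (cong (s *ℤ 1ℤ +ℤ_) (sym (ℤP.neg-distribʳ-* s t)))

  alternatingSum-indicator : {P : Pred A 0ℓ} (P? : Decidable P) → ∀ xs →
    alternatingSum (indicator ∘ All.all? P?) xs ≡ indicator (All.all? (¬? ∘ P?) xs)
  alternatingSum-indicator P? [] = refl
  alternatingSum-indicator P? (y ∷ xs) with P? y
  ... | yes py = alternatingSum-cancel (indicator ∘ All.all? P?) y xs
                   (λ S → indicator-⇔ (All.all? P? (y ∷ S)) (All.all? P? S) All.tail (py ∷_))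
  ... | no ¬py = begin
    ∑ g (map (y ∷_) (sublists xs) ++ sublists xs)   ≡⟨ ∑-++ g (map (y ∷_) (sublists xs)) (sublists xs) ⟩
    ∑ g (map (y ∷_) (sublists xs)) +ℤ ∑ g (sublists xs)
      ≡⟨ cong (_+ℤ ∑ g (sublists xs)) (trans (∑-map g (y ∷_) (sublists xs))
                                              (trans (∑-cong (sublists xs) (λ {S} _ → vanish S)) (∑-zero (sublists xs)))) ⟩
    0ℤ +ℤ ∑ g (sublists xs)                           ≡⟨ ℤP.+-identityˡ _ ⟩
    ∑ g (sublists xs)                                 ≡⟨ alternatingSum-indicator P? xs ⟩
    indicator (All.all? (¬? ∘ P?) xs)                 ∎
    where
    open ≡-Reasoning
    g : List A → ℤ
    g S = negOnePow (length S) *ℤ indicator (All.all? P? S)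
    vanish : ∀ S → g (y ∷ S) ≡ 0ℤ
    vanish S = trans (cong (negOnePow (suc (length S)) *ℤ_) (indicator-no (All.all? P? (y ∷ S)) (¬py ∘ All.head)))
                     (ℤP.*-zeroʳ (negOnePow (suc (length S))))

*≢0⇒≢0 : ∀ {i j} → i *ℤ j ≢ 0ℤ → i ≢ 0ℤ × j ≢ 0ℤ
*≢0⇒≢0 {i} {j} ij≢0 = (λ i≡0 → ij≢0 (trans (cong (_*ℤ j) i≡0) (ℤP.*-zeroˡ j)))
                    , (λ j≡0 → ij≢0 (trans (cong (i *ℤ_) j≡0) (ℤP.*-zeroʳ i)))

module _ {A : Set} (f g : A → ℕ) where

  map-≤⇒≡⊎Lex-< : (∀ x → f x ≤ g x) → ∀ xs → map f xs ≡ map g xs ⊎ Lex-< _≡_ _<_ (map f xs) (map g xs)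
  map-≤⇒≡⊎Lex-< f≤g []       = inj₁ refl
  map-≤⇒≡⊎Lex-< f≤g (x ∷ xs) with f x ℕ.≟ g x
  ... | no fx≢gx = inj₂ (Lex.this (ℕP.≤∧≢⇒< (f≤g x) fx≢gx))
  ... | yes fx≡gx with map-≤⇒≡⊎Lex-< f≤g xs
  ...   | inj₁ fxs≡gxs = inj₁ (cong₂ _∷_ fx≡gx fxs≡gxs)
  ...   | inj₂ fxs<gxs = inj₂ (Lex.next fx≡gx fxs<gxs)

  map-≡⇒∈-≡ : ∀ {xs} → map f xs ≡ map g xs → ∀ {x} → x ∈ xs → f x ≡ g x
  map-≡⇒∈-≡ {_ ∷ _} eq (here refl) = proj₁ (ListP.∷-injective eq)
  map-≡⇒∈-≡ {_ ∷ _} eq (there x∈)  = map-≡⇒∈-≡ (proj₂ (ListP.∷-injective eq)) x∈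

Profile : Set
Profile = List (ℕ × ℕ)

data StandardFrom : ℕ → Profile → Set where
  []  : ∀ {b} → StandardFrom b []
  _∷_ : ∀ {b f a ps} → 0 < a × a + b < f → StandardFrom f ps → StandardFrom b ((f , a) ∷ ps)

-- i lies in the block f ∸ a ≤ i < f of some entry (f , a), written without truncated subtraction.
Removed : Profile → ℕ → Set
Removed ps i = Any (λ (f , a) → f ≤ a + i × i < f) ps

decRemoved : ∀ ps i → Dec (Removed ps i)
decRemoved ps i = Any.any? (λ (f , a) → (f ℕ.≤? a + i) ×-dec (i ℕ.<? f)) ps

RemovedBetween : Profile → ℕ → ℕ → Set
RemovedBetween ps q₀ q = ∀ p → q₀ < p → p < q → Removed ps p

weight≤ : ℕ → Profile → ℕ
weight≤ k []             = 0
weight≤ k ((f , a) ∷ ps) = (if ⌊ f ℕ.≤? k ⌋ then a else 0) + weight≤ k ps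

weight≤-∷-≤ : ∀ {k f} a ps → f ≤ k → weight≤ k ((f , a) ∷ ps) ≡ a + weight≤ k ps
weight≤-∷-≤ {k} {f} a ps f≤k with f ℕ.≤? k
... | yes _  = refl
... | no f≰k = ⊥-elim (f≰k f≤k)

weight≤-∷-> : ∀ {k f} a ps → k < f → weight≤ k ((f , a) ∷ ps) ≡ weight≤ k ps
weight≤-∷-> {k} {f} a ps k<f with f ℕ.≤? k
... | yes f≤k = ⊥-elim (ℕP.<⇒≱ k<f f≤k)
... | no _    = refl

base<rank : ∀ {a b f} → a + b < f → b < f
base<rank {a} {b} = ℕP.≤-<-trans (ℕP.m≤n+m b a)

ranks-above : ∀ {b ps} → StandardFrom b ps → All (λ (f , _) → b < f) ps
ranks-above []                      = []
ranks-above ((_ , a+b<f) ∷ st) = base<rank a+b<f ∷ All.map (ℕP.<-trans (base<rank a+b<f)) (ranks-above st)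

weight≤-below : ∀ {b ps k} → StandardFrom b ps → k ≤ b → weight≤ k ps ≡ 0
weight≤-below []                        k≤b = refl
weight≤-below {ps = (f , a) ∷ ps} (head ∷ st) k≤b =
  trans (weight≤-∷-> a ps (ℕP.≤-<-trans k≤b b<f)) (weight≤-below st (ℕP.≤-trans k≤b (ℕP.<⇒≤ b<f)))
  where b<f = base<rank (proj₂ head)

not-removed-below : ∀ {b ps i} → StandardFrom b ps → i ≤ b → ¬ Removed ps i
not-removed-below ((_ , a+b<f) ∷ st) i≤b (here (f≤a+i , _)) =
  ℕP.<⇒≱ a+b<f (ℕP.≤-trans f≤a+i (ℕP.+-monoʳ-≤ _ i≤b))
not-removed-below ((_ , a+b<f) ∷ st) i≤b (there rem) =
  not-removed-below st (ℕP.≤-trans i≤b (ℕP.<⇒≤ (base<rank a+b<f))) rem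

rank-not-removed : ∀ {b ps f a} → StandardFrom b ps → (f , a) ∈ ps → ¬ Removed ps f
rank-not-removed (_ ∷ st)    (here refl) (here (_ , f<f)) = ℕP.<-irrefl refl f<f
rank-not-removed (_ ∷ st)    (here refl) (there rem)      = not-removed-below st ℕP.≤-refl rem
rank-not-removed (_ ∷ st)    (there e∈)  (here (_ , f<f₀)) = ℕP.<-asym f<f₀ (All.lookup (ranks-above st) e∈)
rank-not-removed (_ ∷ st)    (there e∈)  (there rem)      = rank-not-removed st e∈ rem

gap-without-rank : ∀ {ps q₀ q} → All (λ (f , _) → q < f) ps → q₀ < q → ¬ Removed ps q →
                   RemovedBetween ps q₀ q → q ≡ suc q₀
gap-without-rank {ps} {q₀} {suc q} above q₀<q ¬rem between with suc q₀ ℕ.<? suc q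
... | no  q₀+1≮q    = ℕP.≤-antisym (ℕP.≮⇒≥ q₀+1≮q) q₀<q
... | yes (s≤s q₀<q-1) = ⊥-elim (¬rem (shift above (between q q₀<q-1 ℕP.≤-refl)))
  where
  shift : ∀ {ps} → All (λ (f , _) → suc q < f) ps → Removed ps q → Removed ps (suc q)
  shift (q<f ∷ _)   (here (f≤a+q , _)) = here (ℕP.≤-trans f≤a+q (ℕP.+-monoʳ-≤ _ (ℕP.n≤1+n q)) , q<f)
  shift (_ ∷ above) (there rem)        = there (shift above rem)

gap-ending-at-rank : ∀ {b f a ps q₀} → StandardFrom b ((f , a) ∷ ps) → b ≤ q₀ → q₀ < f →
                     ¬ Removed ((f , a) ∷ ps) q₀ → RemovedBetween ((f , a) ∷ ps) q₀ f → a + suc q₀ ≡ f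
gap-ending-at-rank {b} {f} {a} {ps} {q₀} (_ ∷ st) b≤q₀ q₀<f ¬rem₀ between =
  ℕP.≤-antisym (ℕP.≤-trans (ℕP.≤-reflexive (ℕP.+-suc a q₀)) (ℕP.≰⇒> (λ f≤a+q₀ → ¬rem₀ (here (f≤a+q₀ , q₀<f)))))
               (ℕP.≮⇒≥ (λ a+q₀+1<f → unremoved a+q₀+1<f (between (suc q₀) ℕP.≤-refl (base<rank a+q₀+1<f))))
  where
  unremoved : a + suc q₀ < f → ¬ Removed ((f , a) ∷ ps) (suc q₀)
  unremoved a+q₀+1<f (here (f≤a+q₀+1 , _)) = ℕP.<⇒≱ a+q₀+1<f f≤a+q₀+1
  unremoved a+q₀+1<f (there rem)           = not-removed-below st (ℕP.<⇒≤ (base<rank a+q₀+1<f)) rem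

-- Between consecutive unremoved positions q₀ < q lies either nothing or exactly the
-- removed block of the entry of rank q.
weight≤-gap : ∀ {b ps q₀ q} → StandardFrom b ps → b ≤ q₀ → q₀ < q → ¬ Removed ps q₀ → ¬ Removed ps q →
              RemovedBetween ps q₀ q → weight≤ q ps + suc q₀ ≡ weight≤ q₀ ps + q
weight≤-gap [] _ q₀<q _ ¬rem between = sym (gap-without-rank [] q₀<q ¬rem between)
weight≤-gap {ps = (f , a) ∷ ps} {q₀} {q} st@(head ∷ st′) b≤q₀ q₀<q ¬rem₀ ¬rem between with f ℕ.≤? q₀
... | yes f≤q₀ = begin
  weight≤ q ((f , a) ∷ ps) + suc q₀   ≡⟨ cong (_+ suc q₀) (weight≤-∷-≤ a ps (ℕP.≤-trans f≤q₀ (ℕP.<⇒≤ q₀<q))) ⟩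
  a + weight≤ q ps + suc q₀           ≡⟨ ℕP.+-assoc a _ _ ⟩
  a + (weight≤ q ps + suc q₀)         ≡⟨ cong (a +_) (weight≤-gap st′ f≤q₀ q₀<q (¬rem₀ ∘ there) (¬rem ∘ there) between′) ⟩
  a + (weight≤ q₀ ps + q)             ≡⟨ ℕP.+-assoc a _ _ ⟨
  a + weight≤ q₀ ps + q               ∎
  where
  open ≡-Reasoning
  between′ : RemovedBetween ps q₀ q
  between′ p q₀<p p<q with between p q₀<p p<q
  ... | here (_ , p<f) = ⊥-elim (ℕP.<-asym p<f (ℕP.≤-<-trans f≤q₀ q₀<p))
  ... | there rem      = rem
... | no f≰q₀ with ℕP.<-cmp f q
...   | tri< f<q _ _    = ⊥-elim (rank-not-removed st (here refl) (between f (ℕP.≰⇒> f≰q₀) f<q))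
...   | tri≈ _ refl _ = begin
  weight≤ f ((f , a) ∷ ps) + suc q₀   ≡⟨ cong (_+ suc q₀) (weight≤-∷-≤ a ps ℕP.≤-refl) ⟩
  a + weight≤ f ps + suc q₀           ≡⟨ cong (λ w → a + w + suc q₀) (weight≤-below st′ ℕP.≤-refl) ⟩
  a + 0 + suc q₀                      ≡⟨ cong (_+ suc q₀) (ℕP.+-identityʳ a) ⟩
  a + suc q₀                          ≡⟨ gap-ending-at-rank st b≤q₀ (ℕP.≰⇒> f≰q₀) ¬rem₀ between ⟩
  f                                   ≡⟨ cong (_+ f) (weight≤-below st′ (ℕP.<⇒≤ (ℕP.≰⇒> f≰q₀))) ⟨
  weight≤ q₀ ps + f                   ∎
  where open ≡-Reasoning
...   | tri> _ _ q<f = begin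
  weight≤ q ((f , a) ∷ ps) + suc q₀   ≡⟨ cong (_+ suc q₀) (trans (weight≤-∷-> a ps q<f) (weight≤-below st′ (ℕP.<⇒≤ q<f))) ⟩
  suc q₀                              ≡⟨ gap-without-rank (q<f ∷ All.map (ℕP.<-trans q<f) (ranks-above st′)) q₀<q ¬rem between ⟨
  q                                   ≡⟨ cong (_+ q) (weight≤-below st′ (ℕP.<⇒≤ (ℕP.<-trans q₀<q q<f))) ⟨
  weight≤ q₀ ps + q                   ∎
  where open ≡-Reasoning

rank-in-gap : ∀ {b ps f a q₀ q} → StandardFrom b ps → (f , a) ∈ ps → q₀ < f → f ≤ q →
              RemovedBetween ps q₀ q → f ≡ q
rank-in-gap {f = f} {q = q} st e∈ q₀<f f≤q between with f ℕ.<? q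
... | yes f<q = ⊥-elim (rank-not-removed st e∈ (between f q₀<f f<q))
... | no  f≮q = ℕP.≤-antisym f≤q (ℕP.≮⇒≥ f≮q)

weight≤-attained : ∀ {b ps} → StandardFrom b ps → ∀ k →
                   weight≤ k ps ≡ 0 ⊎ ∃[ e ] e ∈ ps × proj₁ e ≤ k × weight≤ k ps ≡ weight≤ (proj₁ e) ps
weight≤-attained []                           k = inj₁ refl
weight≤-attained {ps = (f , a) ∷ ps} (head ∷ st) k with f ℕ.≤? k
... | no f≰k = inj₁ (weight≤-below st (ℕP.<⇒≤ (ℕP.≰⇒> f≰k)))
... | yes f≤k with weight≤-attained st k
...   | inj₁ w≡0 = inj₂ ((f , a) , here refl , f≤k , (begin
  a + weight≤ k ps                ≡⟨ cong (a +_) (trans w≡0 (sym (weight≤-below st ℕP.≤-refl))) ⟩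
  a + weight≤ f ps                ≡⟨ weight≤-∷-≤ a ps ℕP.≤-refl ⟨
  weight≤ f ((f , a) ∷ ps)        ∎))
  where open ≡-Reasoning
...   | inj₂ (e , e∈ , e≤k , w≡) = inj₂ (e , there e∈ , e≤k ,
  trans (cong (a +_) w≡) (sym (weight≤-∷-≤ a ps (ℕP.<⇒≤ (All.lookup (ranks-above st) e∈)))))

not-removed-above : ∀ {ps i} → All (λ (f , _) → f ≤ i) ps → ¬ Removed ps i
not-removed-above (f≤i ∷ _)   (here (_ , i<f)) = ℕP.<⇒≱ i<f f≤i
not-removed-above (_ ∷ ranks) (there rem)      = not-removed-above ranks rem

gap-arith : ∀ {w₀ w q₀ q ℓ} → w + suc q₀ ≡ w₀ + q → suc (q₀ + ℓ) ≡ q ⇔ w₀ + ℓ ≡ w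
gap-arith {w₀} {w} {q₀} {q} {ℓ} gap = mk⇔
  (λ size → ℕP.+-cancelʳ-≡ (suc q₀) (w₀ + ℓ) w (trans regroup (trans (cong (w₀ +_) size) (sym gap))))
  (λ count → ℕP.+-cancelˡ-≡ w₀ _ _ (trans (sym regroup) (trans (cong (_+ suc q₀) count) gap)))
  where
  open import Data.Nat.Solver using (module +-*-Solver)
  open +-*-Solver
  regroup : w₀ + ℓ + suc q₀ ≡ w₀ + suc (q₀ + ℓ)
  regroup = solve 3 (λ w₀ ℓ q₀ → w₀ :+ ℓ :+ (con 1 :+ q₀) := w₀ :+ (con 1 :+ (q₀ :+ ℓ))) refl w₀ ℓ q₀

data Walk (ps : Profile) (r : ℕ) : ℕ → List ℕ → Set where
  finish : ∀ {q₀} → q₀ < r → RemovedBetween ps q₀ r → Walk ps r q₀ []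
  _∷_    : ∀ {q₀ q qs} → q₀ < q × ¬ Removed ps q × q < r × RemovedBetween ps q₀ q →
           Walk ps r q qs → Walk ps r q₀ (q ∷ qs)

walk : ∀ {ps r q₀ qs} → q₀ < r → All (q₀ <_) qs → AllPairs _<_ qs → All (λ p → ¬ Removed ps p × p < r) qs →
       (∀ p → ¬ Removed ps p → q₀ < p → p < r → p ∈ qs) → Walk ps r q₀ qs
walk {ps} q₀<r [] [] [] complete = finish q₀<r between
  where
  between : RemovedBetween ps _ _
  between p q₀<p p<r with decRemoved ps p
  ... | yes rem = rem
  ... | no ¬rem = case complete p ¬rem q₀<p p<r of λ ()
walk {ps} {r} {q₀} {q ∷ qs} q₀<r (q₀<q ∷ _) (q<qs ∷ sorted) ((¬rem-q , q<r) ∷ essential) complete =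
  (q₀<q , ¬rem-q , q<r , between) ∷ walk q<r q<qs sorted essential complete′
  where
  between : RemovedBetween ps q₀ q
  between p q₀<p p<q with decRemoved ps p
  ... | yes rem = rem
  ... | no ¬rem with complete p ¬rem q₀<p (ℕP.<-trans p<q q<r)
  ...   | here refl = ⊥-elim (ℕP.<-irrefl refl p<q)
  ...   | there p∈  = ⊥-elim (ℕP.<-asym p<q (All.lookup q<qs p∈))
  complete′ : ∀ p → ¬ Removed ps p → q < p → p < r → p ∈ qs
  complete′ p ¬rem q<p p<r with complete p ¬rem (ℕP.<-trans q₀<q q<p) p<r
  ... | here refl = ⊥-elim (ℕP.<-irrefl refl q<p)
  ... | there p∈  = p∈

module _ (M : Matroid) where

  open MatroidDefs M
    renaming (_≤_ to _⊑_; _<_ to _⊏_; _≤?_ to _⊑?_; _<?_ to _⊏?_; _≟_ to _≟F_; ⊥ to ⊥F; ⊤ to ⊤F)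

  open IsBoundedLattice isBoundedLattice
    using (x≤x∨y; y≤x∨y; ∨-least; x∧y≤x; ∧-greatest; antisym)
    renaming (minimum to ⊥-min; maximum to ⊤-max; refl to ⊑-refl; trans to ⊑-trans)

  private
    flatLattice : BoundedLattice 0ℓ 0ℓ 0ℓ
    flatLattice = record { isBoundedLattice = isBoundedLattice }
    open BoundedLattice flatLattice using (joinSemilattice; boundedJoinSemilattice)

  open JoinSemilatticeProperties joinSemilattice using (∨-comm) renaming (x≤y⇒x∨y≈y to ∨-absorbˡ)
  open BoundedJoinSemilatticeProperties boundedJoinSemilattice using () renaming (identityˡ to ⊥-∨)

  ⊏-trans : ∀ {a b c} → a ⊏ b → b ⊏ c → a ⊏ c
  ⊏-trans (a⊑b , a≢b) (b⊑c , b≢c) = ⊑-trans a⊑b b⊑c , λ { refl → a≢b (antisym a⊑b b⊑c) }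

  ⊏-⊑-trans : ∀ {a b c} → a ⊏ b → b ⊑ c → a ⊏ c
  ⊏-⊑-trans (a⊑b , a≢b) b⊑c = ⊑-trans a⊑b b⊑c , λ { refl → a≢b (antisym a⊑b b⊑c) }

  belowCount aboveCount : Fin n → ℕ
  belowCount x = length (filter (_⊑? x) (allFin n))
  aboveCount x = length (filter (x ⊑?_) (allFin n))

  belowCount-< : ∀ {x y} → x ⊏ y → belowCount x < belowCount y
  belowCount-< {x} {y} (x⊑y , x≢y) =
    length-filter-< (_⊑? x) (_⊑? y) (λ z⊑x → ⊑-trans z⊑x x⊑y) (allFin n) (∈P.∈-allFin y)
      (λ y⊑x → x≢y (antisym x⊑y y⊑x)) ⊑-refl

  aboveCount-< : ∀ {x y} → x ⊏ y → aboveCount y < aboveCount x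
  aboveCount-< {x} {y} (x⊑y , x≢y) =
    length-filter-< (y ⊑?_) (x ⊑?_) (⊑-trans x⊑y) (allFin n) (∈P.∈-allFin x)
      (λ y⊑x → x≢y (antisym x⊑y y⊑x)) ⊑-refl

  cover-between : ∀ {a b} → a ⊏ b → ∃[ c ] Covers _⊑_ a c × c ⊑ b
  cover-between {a} {b} = go (<-wellFounded (belowCount b))
    where
    go : ∀ {b} → Acc _<_ (belowCount b) → a ⊏ b → ∃[ c ] Covers _⊑_ a c × c ⊑ b
    go {b} (acc rs) a⊏b with FinP.any? (λ y → (a ⊏? y) ×-dec (y ⊏? b))
    ... | no ∄y = b , (a⊏b , λ y a⊏y⊏b → ∄y (y , a⊏y⊏b)) , ⊑-refl
    ... | yes (y , a⊏y , y⊏b) =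
      let c , a⋖c , c⊑y = go (rs (belowCount-< y⊏b)) a⊏y in c , a⋖c , ⊑-trans c⊑y (proj₁ y⊏b)

  satChain : ∀ {a b} → a ⊑ b → ∃ (SatChain _⊑_ a b)
  satChain {a} = go (<-wellFounded (aboveCount a))
    where
    go : ∀ {a b} → Acc _<_ (aboveCount a) → a ⊑ b → ∃ (SatChain _⊑_ a b)
    go {a} {b} (acc rs) a⊑b with a ≟F b
    ... | yes refl = 0 , done
    ... | no a≢b =
      let c , a⋖c , c⊑b = cover-between (a⊑b , a≢b)
          k , c⇝b = go (rs (aboveCount-< (proj₁ a⋖c))) c⊑b
      in suc k , step a⋖c c⇝b

  satChain-++ : ∀ {a b c k l} → SatChain _⊑_ a b k → SatChain _⊑_ b c l → SatChain _⊑_ a c (k + l)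
  satChain-++ done         b⇝c = b⇝c
  satChain-++ (step a⋖ a⇝b) b⇝c = step a⋖ (satChain-++ a⇝b b⇝c)

  rk⊥ : rk ⊥F ≡ 0
  rk⊥ = sym (ranked ⊥F 0 done)

  rk-satChain : ∀ {a b k} → SatChain _⊑_ a b k → rk b ≡ rk a + k
  rk-satChain {a} {b} {k} a⇝b =
    let k₀ , ⊥⇝a = satChain (⊥-min a)
    in trans (sym (ranked b (k₀ + k) (satChain-++ ⊥⇝a a⇝b))) (cong (_+ k) (ranked a k₀ ⊥⇝a))

  rk-mono : ∀ {a b} → a ⊑ b → rk a ≤ rk b
  rk-mono a⊑b = let k , a⇝b = satChain a⊑b in ℕP.≤-trans (ℕP.m≤m+n _ k) (ℕP.≤-reflexive (sym (rk-satChain a⇝b)))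

  rk-strict : ∀ {a b} → a ⊏ b → rk a < rk b
  rk-strict (a⊑b , a≢b) with satChain a⊑b
  ... | zero  , done = ⊥-elim (a≢b refl)
  ... | suc k , a⇝b  = ℕP.<-≤-trans (ℕP.m<m+n _ (s≤s z≤n)) (ℕP.≤-reflexive (sym (rk-satChain a⇝b)))

  rk-≤⇒≡ : ∀ {a b} → a ⊑ b → rk b ≤ rk a → a ≡ b
  rk-≤⇒≡ {a} {b} a⊑b rkb≤rka with a ≟F b
  ... | yes a≡b = a≡b
  ... | no  a≢b = ⊥-elim (ℕP.<⇒≱ (rk-strict (a⊑b , a≢b)) rkb≤rka)

  rk≤r : ∀ F → rk F ≤ r
  rk≤r F = rk-mono (⊤-max F)

  joinL-ub : ∀ {y} T → y ∈ T → y ⊑ joinL T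
  joinL-ub (z ∷ T) (here refl) = x≤x∨y z (joinL T)
  joinL-ub (z ∷ T) (there y∈) = ⊑-trans (joinL-ub T y∈) (y≤x∨y z (joinL T))

  joinL-lub : ∀ {X} T → All (_⊑ X) T → joinL T ⊑ X
  joinL-lub []      []         = ⊥-min _
  joinL-lub (z ∷ T) (z⊑ ∷ T⊑) = ∨-least z⊑ (joinL-lub T T⊑)

  below notBelow : Fin n → Monomial → Monomial
  below    X = filter (_⊑? X)
  notBelow X = filter (¬? ∘ (_⊑? X))

  count : Fin n → Monomial → ℕ
  count X u = length (below X u)

  count-∷-⊑ : ∀ {X H} u → H ⊑ X → count X (H ∷ u) ≡ suc (count X u)
  count-∷-⊑ {X} u H⊑X = cong length (ListP.filter-accept (_⊑? X) H⊑X)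

  count-∷-≤ : ∀ X H u → count X u ≤ count X (H ∷ u)
  count-∷-≤ X H u with H ⊑? X
  ... | yes _ = ℕP.n≤1+n _
  ... | no _  = ℕP.≤-refl

  count-mono : ∀ {X X′} u → X ⊑ X′ → count X u ≤ count X′ u
  count-mono {X} {X′} u X⊑X′ = length-filter-mono (_⊑? X) (_⊑? X′) u (λ _ y⊑X → ⊑-trans y⊑X X⊑X′)

  count-filter-≤ : ∀ X {P : Pred (Fin n) 0ℓ} (P? : Decidable P) u → count X (filter P? u) ≤ count X u
  count-filter-≤ X P? u = length-filter-sublists (_⊑? X) u (filter∈sublists P? u)

  count-∨-∧ : ∀ X X′ u → count X u + count X′ u ≤ count (X ∨ X′) u + count (X ∧ X′) u
  count-∨-∧ X X′ [] = z≤n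
  count-∨-∧ X X′ (y ∷ u) with y ⊑? X | y ⊑? X′
  ... | yes y⊑X | yes y⊑X′ = begin
    suc (count X u) + suc (count X′ u)         ≡⟨ ℕP.+-suc (suc (count X u)) _ ⟩
    suc (suc (count X u + count X′ u))         ≤⟨ s≤s (s≤s (count-∨-∧ X X′ u)) ⟩
    suc (suc (count (X ∨ X′) u + count (X ∧ X′) u)) ≡⟨ ℕP.+-suc (suc (count (X ∨ X′) u)) _ ⟨
    suc (count (X ∨ X′) u) + suc (count (X ∧ X′) u)
      ≡⟨ cong₂ _+_ (count-∷-⊑ u (⊑-trans y⊑X (x≤x∨y X X′))) (count-∷-⊑ u (∧-greatest y⊑X y⊑X′)) ⟨
    count (X ∨ X′) (y ∷ u) + count (X ∧ X′) (y ∷ u) ∎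
    where open ℕP.≤-Reasoning
  ... | yes y⊑X | no _ = begin
    suc (count X u + count X′ u)                   ≤⟨ s≤s (count-∨-∧ X X′ u) ⟩
    suc (count (X ∨ X′) u + count (X ∧ X′) u)      ≤⟨ s≤s (ℕP.+-monoʳ-≤ _ (count-∷-≤ (X ∧ X′) y u)) ⟩
    suc (count (X ∨ X′) u) + count (X ∧ X′) (y ∷ u) ≡⟨ cong (_+ count (X ∧ X′) (y ∷ u)) (count-∷-⊑ u (⊑-trans y⊑X (x≤x∨y X X′))) ⟨
    count (X ∨ X′) (y ∷ u) + count (X ∧ X′) (y ∷ u) ∎
    where open ℕP.≤-Reasoning
  ... | no _ | yes y⊑X′ = begin
    count X u + suc (count X′ u)                   ≡⟨ ℕP.+-suc (count X u) _ ⟩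
    suc (count X u + count X′ u)                   ≤⟨ s≤s (count-∨-∧ X X′ u) ⟩
    suc (count (X ∨ X′) u + count (X ∧ X′) u)      ≤⟨ s≤s (ℕP.+-monoʳ-≤ _ (count-∷-≤ (X ∧ X′) y u)) ⟩
    suc (count (X ∨ X′) u) + count (X ∧ X′) (y ∷ u) ≡⟨ cong (_+ count (X ∧ X′) (y ∷ u)) (count-∷-⊑ u (⊑-trans y⊑X′ (y≤x∨y X X′))) ⟨
    count (X ∨ X′) (y ∷ u) + count (X ∧ X′) (y ∷ u) ∎
    where open ℕP.≤-Reasoning
  ... | no _ | no _ =
    ℕP.≤-trans (count-∨-∧ X X′ u) (ℕP.+-mono-≤ (count-∷-≤ (X ∨ X′) y u) (count-∷-≤ (X ∧ X′) y u))

  count-interval : ∀ {X₀ X} u → X₀ ⊑ X → count X u ≡ count X₀ u + length (below X (notBelow X₀ u))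
  count-interval {X₀} {X} u X₀⊑X =
    trans (length-filter-partition (_⊑? X) (_⊑? X₀) u) (cong (_+ length (below X (notBelow X₀ u))) below-absorbed)
    where
    below-absorbed : count X (below X₀ u) ≡ count X₀ u
    below-absorbed = cong length (ListP.filter-all (_⊑? X)
                       (All.tabulate (λ y∈ → ⊑-trans (proj₂ (∈P.∈-filter⁻ (_⊑? X₀) {xs = u} y∈)) X₀⊑X)))

  below-⊤ : ∀ u → below ⊤F u ≡ u
  below-⊤ u = ListP.filter-all (_⊑? ⊤F) (All.universal ⊤-max u)

  notBelow-notBelow : ∀ {X₀ X} u → X₀ ⊑ X → notBelow X (notBelow X₀ u) ≡ notBelow X u
  notBelow-notBelow {X₀} {X} u X₀⊑X =
    filter-filter-⇒ (¬? ∘ (_⊑? X)) (¬? ∘ (_⊑? X₀)) (λ y⋢X y⊑X₀ → y⋢X (⊑-trans y⊑X₀ X₀⊑X)) u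

  count-↭ : ∀ X {u v} → u ↭ v → count X u ≡ count X v
  count-↭ X u↭v = ↭-length (filter-↭ (_⊑? X) u↭v)

  Hall : Fin n → Monomial → Set
  Hall B u = ∀ X → 0 < count X u → rk B + count X u < rk (B ∨ X)

  hall? : ∀ B u → Dec (Hall B u)
  hall? B u = FinP.all? λ X → (0 ℕ.<? count X u) →-dec (rk B + count X u ℕ.<? rk (B ∨ X))

  DegOne : Fin n → Fin n → Monomial → Set
  DegOne B G u = suc (rk B + length u) ≡ rk G × Hall B u

  degOne? : ∀ B G u → Dec (DegOne B G u)
  degOne? B G u = (suc (rk B + length u) ℕ.≟ rk G) ×-dec hall? B u

  ideg : Fin n → Fin n → Monomial → ℤ
  ideg B G u = indicator (degOne? B G u)

  hall-∷⁻ : ∀ {B H u} → Hall B (H ∷ u) → Hall B u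
  hall-∷⁻ {B} {H} {u} hall X 0<c =
    ℕP.≤-<-trans (ℕP.+-monoʳ-≤ (rk B) (count-∷-≤ X H u)) (hall X (ℕP.<-≤-trans 0<c (count-∷-≤ X H u)))

  hall-filter : ∀ {B u} {P : Pred (Fin n) 0ℓ} (P? : Decidable P) → Hall B u → Hall B (filter P? u)
  hall-filter {B} {u} P? hall X 0<c =
    ℕP.≤-<-trans (ℕP.+-monoʳ-≤ (rk B) (count-filter-≤ X P? u)) (hall X (ℕP.<-≤-trans 0<c (count-filter-≤ X P? u)))

  hall-bound : ∀ {B W u} → Hall B u → B ⊑ W → rk B + count W u ≤ rk W
  hall-bound {B} {W} {u} hall B⊑W with count W u ℕ.≟ 0
  ... | yes c≡0 = subst (λ k → rk B + k ≤ rk W) (sym c≡0) (ℕP.≤-trans (ℕP.≤-reflexive (ℕP.+-identityʳ _)) (rk-mono B⊑W))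
  ... | no c≢0  = ℕP.<⇒≤ (subst (λ Z → rk B + count W u < rk Z) (∨-absorbˡ B⊑W) (hall W (ℕP.n≢0⇒n>0 c≢0)))

  hall-bound-strict : ∀ {B W u} → Hall B u → B ⊏ W → rk B + count W u < rk W
  hall-bound-strict {B} {W} {u} hall B⊏W with count W u ℕ.≟ 0
  ... | yes c≡0 = subst (λ k → rk B + k < rk W) (sym c≡0) (ℕP.≤-trans (ℕP.≤-reflexive (cong suc (ℕP.+-identityʳ _))) (rk-strict B⊏W))
  ... | no c≢0  = subst (λ Z → rk B + count W u < rk Z) (∨-absorbˡ (proj₁ B⊏W)) (hall W (ℕP.n≢0⇒n>0 c≢0))

  degOne-↭ : ∀ {B G u v} → u ↭ v → DegOne B G u → DegOne B G v
  degOne-↭ {B} u↭v (size , hall) =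
    trans (cong (λ k → suc (rk B + k)) (sym (↭-length u↭v))) size ,
    λ X 0<c → subst (λ k → rk B + k < rk (B ∨ X)) (count-↭ X u↭v) (hall X (subst (0 <_) (sym (count-↭ X u↭v)) 0<c))

  ideg-↭ : ∀ B G {u v} → u ↭ v → ideg B G u ≡ ideg B G v
  ideg-↭ B G {u} {v} u↭v = indicator-⇔ (degOne? B G u) (degOne? B G v) (degOne-↭ u↭v) (degOne-↭ (↭-sym u↭v))

  SublistCondition : Monomial → Set
  SublistCondition u = All (λ T → length T ≡ 0 ⊎ suc (length T) ≤ rk (joinL T)) (sublists u)

  sublistCondition⇒hall : ∀ u → SublistCondition u → Hall ⊥F u
  sublistCondition⇒hall u cond X 0<c with All.lookup cond (filter∈sublists (_⊑? X) u)
  ... | inj₁ len≡0 = ⊥-elim (ℕP.<⇒≢ 0<c (sym len≡0))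
  ... | inj₂ large =
    subst₂ _<_ (cong (_+ count X u) (sym rk⊥)) (cong rk (sym (⊥-∨ X)))
      (ℕP.<-≤-trans large (rk-mono (joinL-lub (below X u) (All.tabulate (proj₂ ∘ ∈P.∈-filter⁻ (_⊑? X) {xs = u})))))

  hall⇒sublistCondition : ∀ u → Hall ⊥F u → SublistCondition u
  hall⇒sublistCondition u hall = All.tabulate (λ {T} → bound T)
    where
    bound : ∀ T → T ∈ sublists u → length T ≡ 0 ⊎ suc (length T) ≤ rk (joinL T)
    bound []      _  = inj₁ refl
    bound (y ∷ T) T∈ = inj₂ (begin
      suc (length (y ∷ T))      ≡⟨ cong suc count-T ⟨
      suc (count X (y ∷ T))     ≤⟨ s≤s T≤u ⟩
      suc (count X u)           ≡⟨ cong (λ k → suc (k + count X u)) (sym rk⊥) ⟩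
      suc (rk ⊥F + count X u)   ≤⟨ hall X (ℕP.<-≤-trans (s≤s z≤n) (ℕP.≤-trans (ℕP.≤-reflexive (sym count-T)) T≤u)) ⟩
      rk (⊥F ∨ X)               ≡⟨ cong rk (⊥-∨ X) ⟩
      rk X                      ∎)
      where
      open ℕP.≤-Reasoning
      X = joinL (y ∷ T)
      count-T : count X (y ∷ T) ≡ length (y ∷ T)
      count-T = cong length (ListP.filter-all (_⊑? X) (All.tabulate (joinL-ub (y ∷ T))))
      T≤u : count X (y ∷ T) ≤ count X u
      T≤u = length-filter-sublists (_⊑? X) u T∈

  degMono≡ideg : ∀ u → degMono u ≡ ideg ⊥F ⊤F u
  degMono≡ideg u =
    trans (isYes-and-indicator (suc (length u) ℕ.≟ r) sublistCondition?)
          (indicator-⇔ ((suc (length u) ℕ.≟ r) ×-dec sublistCondition?) (degOne? ⊥F ⊤F u)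
            (Product.map (trans (cong (λ k → suc (k + length u)) rk⊥)) (sublistCondition⇒hall u))
            (Product.map (trans (cong (λ k → suc (k + length u)) (sym rk⊥))) (hall⇒sublistCondition u)))
    where
    sublistCondition? : Dec (SublistCondition u)
    sublistCondition? = All.all? (λ T → (length T ℕ.≟ 0) ⊎-dec (suc (length T) ℕ.≤? rk (joinL T))) (sublists u)

  lin : (Monomial → ℤ) → Poly → ℤ
  lin f = ∑ (λ (c , u) → c *ℤ f u)

  deg≡lin-ideg : ∀ p → deg p ≡ lin (ideg ⊥F ⊤F) p
  deg≡lin-ideg []            = refl
  deg≡lin-ideg ((c , u) ∷ p) = cong₂ (λ d e → c *ℤ d +ℤ e) (degMono≡ideg u) (deg≡lin-ideg p)

  lin-+ : ∀ f g q → lin (λ v → f v +ℤ g v) q ≡ lin f q +ℤ lin g q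
  lin-+ f g q = trans (∑-cong q (λ {(d , v)} _ → ℤP.*-distribˡ-+ d (f v) (g v))) (∑-+ _ _ q)

  lin-scale : ∀ c f q → lin (λ v → c *ℤ f v) q ≡ c *ℤ lin f q
  lin-scale c f q = trans (∑-cong q (λ {(d , v)} _ → *-leftComm d c (f v))) (∑-scale c _ q)

  lin-zero : ∀ q → lin (λ _ → 0ℤ) q ≡ 0ℤ
  lin-zero q = trans (∑-cong q (λ {(d , _)} _ → ℤP.*-zeroʳ d)) (∑-zero q)

  lin-monomial : ∀ f u → lin f ((1ℤ , u) ∷ []) ≡ f u
  lin-monomial f u = trans (ℤP.+-identityʳ _) (ℤP.*-identityˡ (f u))

  lin-cong : ∀ {f g} q → (∀ v → f v ≡ g v) → lin f q ≡ lin g q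
  lin-cong q f≗g = ∑-cong q (λ {(c , v)} _ → cong (c *ℤ_) (f≗g v))

  lin-*P : ∀ f p q → lin f (p *P q) ≡ lin (λ v → lin (λ u → f (u ++ v)) p) q
  lin-*P f []            q = sym (lin-zero q)
  lin-*P f ((c , u) ∷ p) q = begin
    lin f (map _ q ++ p *P q)                                       ≡⟨ ∑-++ _ (map _ q) (p *P q) ⟩
    lin f (map _ q) +ℤ lin f (p *P q)                               ≡⟨ cong₂ _+ℤ_ head (lin-*P f p q) ⟩
    lin (λ v → c *ℤ f (u ++ v)) q +ℤ lin (λ v → lin (λ w → f (w ++ v)) p) q ≡⟨ lin-+ _ _ q ⟨
    lin (λ v → c *ℤ f (u ++ v) +ℤ lin (λ w → f (w ++ v)) p) q       ∎
    where
    open ≡-Reasoning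
    head : lin f (map (λ (d , v) → c *ℤ d , u ++ v) q) ≡ lin (λ v → c *ℤ f (u ++ v)) q
    head = trans (∑-map _ _ q) (∑-cong q (λ {(d , v)} _ → trans (ℤP.*-assoc c d (f (u ++ v))) (*-leftComm c d _)))

  Supported : Pred (Fin n) 0ℓ → Poly → Set
  Supported R p = All (All R ∘ proj₂) p

  Supported-map : ∀ {R R′ : Pred (Fin n) 0ℓ} → (∀ {y} → R y → R′ y) → ∀ {p} → Supported R p → Supported R′ p
  Supported-map R⇒R′ = All.map (All.map R⇒R′)

  lin-cong-supported : ∀ {R f g p} → Supported R p → (∀ {v} → All R v → f v ≡ g v) → lin f p ≡ lin g p
  lin-cong-supported {p = p} Rp f≗g = ∑-cong p (λ {(c , _)} u∈ → cong (c *ℤ_) (f≗g (All.lookup Rp u∈)))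

  *P-supported : ∀ {R} p q → Supported R p → Supported R q → Supported R (p *P q)
  *P-supported p q Rp Rq = AllP.concat⁺ (AllP.map⁺ (All.map (λ Ru → AllP.map⁺ (All.map (AllP.++⁺ Ru) Rq)) Rp))

  x-supported : ∀ G → Supported (G ⊑_) (x G)
  x-supported G = AllP.map⁺ (All.tabulate (λ {S} _ → x≤x∨y G (joinL S) ∷ []))

  ∈-atomsNotBelow : ∀ {G a} → Atom a → ¬ a ⊑ G → a ∈ atomsNotBelow G
  ∈-atomsNotBelow {G} {a} atom-a a⋢G =
    ∈P.∈-filter⁺ (λ a → atom? a ×-dec ¬? (a ⊑? G)) (∈P.∈-allFin a) (atom-a , a⋢G)

  ∈-atomsNotBelow⁻ : ∀ {G a} → a ∈ atomsNotBelow G → ¬ a ⊑ G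
  ∈-atomsNotBelow⁻ {G} a∈ = proj₂ (proj₂ (∈P.∈-filter⁻ (λ a → atom? a ×-dec ¬? (a ⊑? G)) {xs = allFin n} a∈))

  avoidsAtomsNotBelow⇒⊑ : ∀ {F G} → All (λ a → ¬ a ⊑ F) (atomsNotBelow G) → F ⊑ G
  avoidsAtomsNotBelow⇒⊑ {F} {G} none = atomic F G atom⊑G
    where
    atom⊑G : ∀ a → Atom a → a ⊑ F → a ⊑ G
    atom⊑G a atom-a a⊑F with a ⊑? G
    ... | yes a⊑G = a⊑G
    ... | no a⋢G  = ⊥-elim (All.lookup none (∈-atomsNotBelow atom-a a⋢G) a⊑F)

  atomsNotBelow≢[] : ∀ {G} → G ≢ ⊤F → atomsNotBelow G ≢ []
  atomsNotBelow≢[] {G} G≢⊤ A≡[] = G≢⊤ (antisym (⊤-max G) (avoidsAtomsNotBelow⇒⊑ (subst (All _) (sym A≡[]) [])))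

  module Factorisation {B G : Fin n} (B⊏G : B ⊏ G) (u : Monomial) where

    L Y : Monomial
    L = below G u
    Y = notBelow G u

    count-split : ∀ X → count X u ≡ count X L + count X Y
    count-split X = length-filter-partition (_⊑? X) (_⊑? G) u

    count-L-above : ∀ {X} → G ⊑ X → count X L ≡ length L
    count-L-above {X} G⊑X =
      cong length (ListP.filter-all (_⊑? X) (All.tabulate (λ y∈ → ⊑-trans (proj₂ (∈P.∈-filter⁻ (_⊑? G) {xs = u} y∈)) G⊑X)))

    size-split : suc (rk B + length L) ≡ rk G → suc (rk G + length Y) ≡ suc (rk B + suc (length u))
    size-split size-L = begin
      suc (rk G + length Y)                       ≡⟨ cong (λ k → suc (k + length Y)) (sym size-L) ⟩
      suc (suc (rk B + length L) + length Y)      ≡⟨ cong suc (cong suc (ℕP.+-assoc (rk B) (length L) (length Y))) ⟩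
      suc (suc (rk B + (length L + length Y)))    ≡⟨ cong (λ k → suc (suc (rk B + k))) (sym (length-partition (_⊑? G) u)) ⟩
      suc (suc (rk B + length u))                 ≡⟨ cong suc (ℕP.+-suc (rk B) (length u)) ⟨
      suc (rk B + suc (length u))                 ∎
      where open ≡-Reasoning

    -- X is tight when one more factor below X would break Hall's inequality at X.
    Tight : Fin n → Set
    Tight X = G ⊑ X × rk X ≤ suc (rk B + count X u)

    tight? : ∀ X → Dec (Tight X)
    tight? X = (G ⊑? X) ×-dec (rk X ℕ.≤? suc (rk B + count X u))

    tight⇒¬hall : ∀ {H X} → Tight X → H ⊑ X → ¬ Hall B (H ∷ u)
    tight⇒¬hall {H} {X} (G⊑X , rkX≤) H⊑X hall = ℕP.<⇒≱ violation (ℕP.≤-trans rkX≤ (ℕP.≤-reflexive (sym (ℕP.+-suc (rk B) _))))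
      where
      violation : rk B + suc (count X u) < rk X
      violation = subst₂ (λ k Z → rk B + k < rk Z) (count-∷-⊑ u H⊑X) (∨-absorbˡ (⊑-trans (proj₁ B⊏G) G⊑X))
                    (hall X (subst (0 <_) (sym (count-∷-⊑ u H⊑X)) (s≤s z≤n)))

    ¬hall⇒tight : ∀ {H} → Hall B u → G ⊑ H → ¬ Hall B (H ∷ u) → ∃[ X ] Tight X × H ⊑ X
    ¬hall⇒tight {H} hall G⊑H ¬hall
      with FinP.¬∀⟶∃¬ n _ (λ X → (0 ℕ.<? count X (H ∷ u)) →-dec (rk B + count X (H ∷ u) ℕ.<? rk (B ∨ X))) ¬hall
    ... | X , ¬ok with H ⊑? X
    ...   | no _ = ⊥-elim (¬ok (hall X))
    ...   | yes H⊑X = B ∨ X , (⊑-trans G⊑H H⊑B∨X , rk-bound) , H⊑B∨X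
      where
      H⊑B∨X : H ⊑ (B ∨ X)
      H⊑B∨X = ⊑-trans H⊑X (y≤x∨y B X)
      rk-bound : rk (B ∨ X) ≤ suc (rk B + count (B ∨ X) u)
      rk-bound = begin
        rk (B ∨ X)                    ≤⟨ ℕP.≮⇒≥ (λ lt → ¬ok (λ _ → lt)) ⟩
        rk B + suc (count X u)        ≡⟨ ℕP.+-suc (rk B) _ ⟩
        suc (rk B + count X u)        ≤⟨ s≤s (ℕP.+-monoʳ-≤ (rk B) (count-mono u (y≤x∨y B X))) ⟩
        suc (rk B + count (B ∨ X) u)  ∎
        where open ℕP.≤-Reasoning

    tight-∨ : Hall B u → ∀ {X X′} → Tight X → Tight X′ → Tight (X ∨ X′)
    tight-∨ hall {X} {X′} (G⊑X , rkX≤) (G⊑X′ , rkX′≤) =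
      ⊑-trans G⊑X (x≤x∨y X X′) , ℕP.+-cancelʳ-≤ (suc (b + count W u)) _ _ (begin
        rk (X ∨ X′) + suc (b + count W u)                   ≤⟨ ℕP.+-monoʳ-≤ (rk (X ∨ X′)) W-bound ⟩
        rk (X ∨ X′) + rk W                                  ≤⟨ submodular X X′ ⟩
        rk X + rk X′                                        ≤⟨ ℕP.+-mono-≤ rkX≤ rkX′≤ ⟩
        suc (b + count X u) + suc (b + count X′ u)          ≡⟨ regroup b (count X u) (count X′ u) ⟩
        suc b + suc b + (count X u + count X′ u)            ≤⟨ ℕP.+-monoʳ-≤ (suc b + suc b) (count-∨-∧ X X′ u) ⟩
        suc b + suc b + (count (X ∨ X′) u + count W u)      ≡⟨ regroup b (count (X ∨ X′) u) (count W u) ⟨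
        suc (b + count (X ∨ X′) u) + suc (b + count W u)    ∎)
      where
      open ℕP.≤-Reasoning
      open import Data.Nat.Solver using (module +-*-Solver)
      open +-*-Solver
      b = rk B
      W = X ∧ X′
      W-bound : suc (b + count W u) ≤ rk W
      W-bound = hall-bound-strict {u = u} hall (⊏-⊑-trans B⊏G (∧-greatest G⊑X G⊑X′))
      regroup : ∀ b x y → suc (b + x) + suc (b + y) ≡ suc b + suc b + (x + y)
      regroup = solve 3 (λ b x y → (con 1 :+ (b :+ x)) :+ (con 1 :+ (b :+ y)) := (con 1 :+ b) :+ (con 1 :+ b) :+ (x :+ y)) refl

    greatest-tight : Hall B u → ∃ Tight → ∃[ K ] Tight K × (∀ {X} → Tight X → X ⊑ K)
    greatest-tight hall (X₀ , tight₀) =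
      foldr _∨_ X₀ tights ,
      fold-tight tights (All.tabulate (proj₂ ∘ ∈P.∈-filter⁻ tight? {xs = allFin n})) ,
      λ {X} tight → fold-ub tights (∈P.∈-filter⁺ tight? (∈P.∈-allFin X) tight)
      where
      tights : List (Fin n)
      tights = filter tight? (allFin n)
      fold-tight : ∀ T → All Tight T → Tight (foldr _∨_ X₀ T)
      fold-tight []      []          = tight₀
      fold-tight (X ∷ T) (tX ∷ tT) = tight-∨ hall tX (fold-tight T tT)
      fold-ub : ∀ {X} T → X ∈ T → X ⊑ foldr _∨_ X₀ T
      fold-ub (Z ∷ T) (here refl) = x≤x∨y Z _
      fold-ub (Z ∷ T) (there X∈)  = ⊑-trans (fold-ub T X∈) (y≤x∨y Z _)

    count-L-meet : ∀ Z → count Z L ≤ count (Z ∧ G) L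
    count-L-meet Z = length-filter-mono (_⊑? Z) (_⊑? (Z ∧ G)) L
                       (λ y∈L y⊑Z → ∧-greatest y⊑Z (proj₂ (∈P.∈-filter⁻ (_⊑? G) {xs = u} y∈L)))

    bound-missing-Y : DegOne B G L → ∀ {Z} → B ⊑ Z → 0 < count Z u → count Z Y ≡ 0 → rk B + count Z u < rk Z
    bound-missing-Y (_ , hall-L) {Z} B⊑Z 0<cZ cZY≡0 = begin-strict
      rk B + count Z u         ≡⟨ cong (rk B +_) cZ≡cZL ⟩
      rk B + count Z L         ≤⟨ ℕP.+-monoʳ-≤ (rk B) (count-L-meet Z) ⟩
      rk B + count (Z ∧ G) L   <⟨ hall-L (Z ∧ G) (ℕP.<-≤-trans (subst (0 <_) cZ≡cZL 0<cZ) (count-L-meet Z)) ⟩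
      rk (B ∨ (Z ∧ G))         ≡⟨ cong rk (∨-absorbˡ (∧-greatest B⊑Z (proj₁ B⊏G))) ⟩
      rk (Z ∧ G)               ≤⟨ rk-mono (x∧y≤x Z G) ⟩
      rk Z                     ∎
      where
      open ℕP.≤-Reasoning
      cZ≡cZL : count Z u ≡ count Z L
      cZ≡cZL = trans (count-split Z) (trans (cong (count Z L +_) cZY≡0) (ℕP.+-identityʳ _))

    bound-meeting-Y : DegOne B G L → DegOne G ⊤F Y → ∀ {Z} → B ⊑ Z → 0 < count Z Y → rk B + count Z u < rk Z
    bound-meeting-Y (_ , hall-L) (_ , hall-Y) {Z} B⊑Z 0<cZY = ℕP.+-cancelʳ-≤ (rk G) _ _ (begin
      suc (rk B + count Z u) + rk G                   ≡⟨ cong (λ k → suc (rk B + k) + rk G) (count-split Z) ⟩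
      suc (rk B + (count Z L + count Z Y)) + rk G     ≡⟨ regroup (rk B) (rk G) (count Z L) (count Z Y) ⟩
      suc (rk G + count Z Y) + (rk B + count Z L)
        ≤⟨ ℕP.+-mono-≤ (hall-Y Z 0<cZY) (ℕP.≤-trans (ℕP.+-monoʳ-≤ (rk B) (count-L-meet Z))
                                                       (hall-bound {u = L} hall-L (∧-greatest B⊑Z (proj₁ B⊏G)))) ⟩
      rk (G ∨ Z) + rk (Z ∧ G)                         ≡⟨ cong (λ V → rk V + rk (Z ∧ G)) (∨-comm G Z) ⟩
      rk (Z ∨ G) + rk (Z ∧ G)                         ≤⟨ submodular Z G ⟩
      rk Z + rk G                                     ∎)
      where
      open ℕP.≤-Reasoning
      open import Data.Nat.Solver using (module +-*-Solver)
      open +-*-Solver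
      regroup : ∀ b g l y → suc (b + (l + y)) + g ≡ suc (g + y) + (b + l)
      regroup = solve 4 (λ b g l y → (con 1 :+ (b :+ (l :+ y))) :+ g := (con 1 :+ (g :+ y)) :+ (b :+ l)) refl

    factors⇒hall : DegOne B G L → DegOne G ⊤F Y → Hall B u
    factors⇒hall degOne-L degOne-Y X 0<cX =
      ℕP.≤-<-trans (ℕP.+-monoʳ-≤ (rk B) X≤Z) (join-bound (count Z Y ℕ.≟ 0))
      where
      Z : Fin n
      Z = B ∨ X
      X≤Z : count X u ≤ count Z u
      X≤Z = count-mono u (y≤x∨y B X)
      join-bound : Dec (count Z Y ≡ 0) → rk B + count Z u < rk Z
      join-bound (yes cZY≡0) = bound-missing-Y degOne-L (x≤x∨y B X) (ℕP.<-≤-trans 0<cX X≤Z) cZY≡0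
      join-bound (no cZY≢0)  = bound-meeting-Y degOne-L degOne-Y (x≤x∨y B X) (ℕP.n≢0⇒n>0 cZY≢0)

    both? : Dec (DegOne B G L × DegOne G ⊤F Y)
    both? = degOne? B G L ×-dec degOne? G ⊤F Y

    deg-∷ : List (Fin n) → ℤ
    deg-∷ S = ideg B ⊤F ((G ∨ joinL S) ∷ u)

    vanishing : G ≢ ⊤F → ∀ c → (∀ S → deg-∷ S ≡ c) → ¬ (DegOne B G L × DegOne G ⊤F Y) →
                - alternatingSum deg-∷ (atomsNotBelow G) ≡ indicator both?
    vanishing G≢⊤ c deg≡c ¬both =
      trans (cong -_ (alternatingSum-const c (atomsNotBelow G) (atomsNotBelow≢[] G≢⊤) deg≡c)) (sym (indicator-no both? ¬both))

    factors⇒tight : DegOne B G L → Tight G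
    factors⇒tight (size-L , _) = ⊑-refl , ℕP.≤-reflexive (sym size-L)

    factors⇒atomsAvoid : ∀ {K} → Tight K → DegOne B G L → DegOne G ⊤F Y → All (λ a → ¬ a ⊑ K) (atomsNotBelow G)
    factors⇒atomsAvoid {K} (G⊑K , rkK≤) (size-L , _) (_ , hall-Y) =
      All.tabulate (λ a∈ a⊑K → ∈-atomsNotBelow⁻ a∈ (⊑-trans a⊑K K⊑G))
      where
      K⊑G : K ⊑ G
      K⊑G with K ≟F G
      ... | yes refl = ⊑-refl
      ... | no K≢G   = ⊥-elim (ℕP.<⇒≱ (hall-bound-strict {u = Y} hall-Y (G⊑K , K≢G ∘ sym)) (begin
        rk K                                       ≤⟨ rkK≤ ⟩
        suc (rk B + count K u)                     ≡⟨ cong (λ k → suc (rk B + k)) (count-split K) ⟩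
        suc (rk B + (count K L + count K Y))       ≡⟨ cong (λ k → suc (rk B + (k + count K Y))) (count-L-above G⊑K) ⟩
        suc (rk B + (length L + count K Y))        ≡⟨ cong suc (ℕP.+-assoc (rk B) (length L) (count K Y)) ⟨
        suc (rk B + length L) + count K Y          ≡⟨ cong (_+ count K Y) size-L ⟩
        rk G + count K Y                           ∎))
        where open ℕP.≤-Reasoning

    module _ (size : suc (rk B + suc (length u)) ≡ r) (hall : Hall B u)
             {K : Fin n} (tight-K : Tight K) (K-greatest : ∀ {X} → Tight X → X ⊑ K) where

      deg-∷-tight : ∀ S → deg-∷ S ≡ 1ℤ ℤ.- indicator (All.all? (_⊑? K) S)
      deg-∷-tight S with All.all? (_⊑? K) S
      ... | yes S⊑K = indicator-no (degOne? B ⊤F _) (tight⇒¬hall tight-K (∨-least (proj₁ tight-K) (joinL-lub S S⊑K)) ∘ proj₂)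
      ... | no S⋢K  = indicator-yes (degOne? B ⊤F _) (size , hall-∷)
        where
        hall-∷ : Hall B ((G ∨ joinL S) ∷ u)
        hall-∷ with hall? B ((G ∨ joinL S) ∷ u)
        ... | yes hall′ = hall′
        ... | no ¬hall′ =
          let X , tight-X , H⊑X = ¬hall⇒tight hall (x≤x∨y G (joinL S)) ¬hall′
              H⊑K = ⊑-trans H⊑X (K-greatest tight-X)
          in ⊥-elim (S⋢K (All.tabulate (λ a∈S → ⊑-trans (joinL-ub S a∈S) (⊑-trans (y≤x∨y G (joinL S)) H⊑K))))

      atomsAvoid⇒factors : All (λ a → ¬ a ⊑ K) (atomsNotBelow G) → DegOne B G L × DegOne G ⊤F Y
      atomsAvoid⇒factors avoid = (size-L , hall-filter {u = u} (_⊑? G) hall) , (trans (size-split size-L) size , hall-Y)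
        where
        K≡G : K ≡ G
        K≡G = antisym (avoidsAtomsNotBelow⇒⊑ avoid) (proj₁ tight-K)
        size-L : suc (rk B + length L) ≡ rk G
        size-L = ℕP.≤-antisym (hall-bound-strict {u = u} hall B⊏G) (proj₂ (subst Tight K≡G tight-K))
        hall-Y : Hall G Y
        hall-Y X 0<cXY with ∃∈-filter (_⊑? X) Y 0<cXY
        ... | y , y∈Y , y⊑X = begin-strict
          rk G + count X Y                                   ≡⟨ cong (_+ count X Y) (sym size-L) ⟩
          suc (rk B + length L) + count X Y                  ≡⟨ cong suc (ℕP.+-assoc (rk B) (length L) (count X Y)) ⟩
          suc (rk B + (length L + count X Y))                ≤⟨ s≤s (ℕP.+-monoʳ-≤ (rk B) (ℕP.+-monoʳ-≤ (length L) (count-mono Y (y≤x∨y G X)))) ⟩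
          suc (rk B + (length L + count (G ∨ X) Y))          ≡⟨ cong (λ k → suc (rk B + (k + count (G ∨ X) Y))) (count-L-above (x≤x∨y G X)) ⟨
          suc (rk B + (count (G ∨ X) L + count (G ∨ X) Y))   ≡⟨ cong (λ k → suc (rk B + k)) (count-split (G ∨ X)) ⟨
          suc (rk B + count (G ∨ X) u)                       <⟨ ℕP.≰⇒> (λ rk≤ → ¬tight (x≤x∨y G X , rk≤)) ⟩
          rk (G ∨ X)                                         ∎
          where
          open ℕP.≤-Reasoning
          ¬tight : ¬ Tight (G ∨ X)
          ¬tight tight = proj₂ (∈P.∈-filter⁻ (¬? ∘ (_⊑? G)) {xs = u} y∈Y)
                           (⊑-trans y⊑X (⊑-trans (y≤x∨y G X) (subst ((G ∨ X) ⊑_) K≡G (K-greatest tight))))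

      alternatingSum-tight : G ≢ ⊤F → - alternatingSum deg-∷ (atomsNotBelow G) ≡ indicator both?
      alternatingSum-tight G≢⊤ = begin
        - alternatingSum deg-∷ A                     ≡⟨ cong -_ (alternatingSum-cong A deg-∷-tight) ⟩
        - alternatingSum (λ S → 1ℤ ℤ.- below-K S) A  ≡⟨ cong -_ (alternatingSum-complement below-K A (atomsNotBelow≢[] G≢⊤)) ⟩
        - - alternatingSum below-K A                 ≡⟨ ℤP.neg-involutive _ ⟩
        alternatingSum below-K A                     ≡⟨ alternatingSum-indicator (_⊑? K) A ⟩
        indicator (All.all? (¬? ∘ (_⊑? K)) A)
          ≡⟨ indicator-⇔ (All.all? (¬? ∘ (_⊑? K)) A) both? atomsAvoid⇒factors
                          (λ (degOne-L , degOne-Y) → factors⇒atomsAvoid tight-K degOne-L degOne-Y) ⟩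
        indicator both?                              ∎
        where
        open ≡-Reasoning
        A : List (Fin n)
        A = atomsNotBelow G
        below-K : List (Fin n) → ℤ
        below-K S = indicator (All.all? (_⊑? K) S)

    alternatingSum-deg-∷ : G ≢ ⊤F → - alternatingSum deg-∷ (atomsNotBelow G) ≡ indicator both?
    alternatingSum-deg-∷ G≢⊤ with suc (rk B + suc (length u)) ℕ.≟ r | hall? B u | FinP.any? tight?
    ... | no ¬size | _ | _ =
      vanishing G≢⊤ 0ℤ (λ S → indicator-no (degOne? B ⊤F _) (¬size ∘ proj₁))
        (λ (degOne-L , degOne-Y) → ¬size (trans (sym (size-split (proj₁ degOne-L))) (proj₁ degOne-Y)))
    ... | yes _ | no ¬hall | _ =
      vanishing G≢⊤ 0ℤ (λ S → indicator-no (degOne? B ⊤F _) (¬hall ∘ hall-∷⁻ ∘ proj₂))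
        (λ (degOne-L , degOne-Y) → ¬hall (factors⇒hall degOne-L degOne-Y))
    ... | yes size | yes hall | no ∄tight =
      vanishing G≢⊤ 1ℤ (λ S → indicator-yes (degOne? B ⊤F _) (size , hall-∷ S))
        (λ (degOne-L , _) → ∄tight (G , factors⇒tight degOne-L))
      where
      hall-∷ : ∀ S → Hall B ((G ∨ joinL S) ∷ u)
      hall-∷ S with hall? B ((G ∨ joinL S) ∷ u)
      ... | yes hall′ = hall′
      ... | no ¬hall′ = ⊥-elim (∄tight (Product.map₂ proj₁ (¬hall⇒tight hall (x≤x∨y G (joinL S)) ¬hall′)))
    ... | yes size | yes hall | yes ∃tight =
      let K , tight-K , K-greatest = greatest-tight hall ∃tight in alternatingSum-tight size hall tight-K K-greatest G≢⊤

    lin-x : G ≢ ⊤F → lin (λ w → ideg B ⊤F (w ++ u)) (x G) ≡ ideg B G L *ℤ ideg G ⊤F Y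
    lin-x G≢⊤ = begin
      lin (λ w → ideg B ⊤F (w ++ u)) (x G)                          ≡⟨ ∑-map _ _ (sublists A) ⟩
      ∑ (λ S → - negOnePow (length S) *ℤ deg-∷ S) (sublists A)
        ≡⟨ ∑-cong (sublists A) (λ {S} _ → sym (ℤP.neg-distribˡ-* (negOnePow (length S)) (deg-∷ S))) ⟩
      ∑ (λ S → - (negOnePow (length S) *ℤ deg-∷ S)) (sublists A)    ≡⟨ ∑-neg _ (sublists A) ⟩
      - alternatingSum deg-∷ A                                      ≡⟨ alternatingSum-deg-∷ G≢⊤ ⟩
      indicator both?                                                ≡⟨ indicator-× (degOne? B G L) (degOne? G ⊤F Y) ⟩
      ideg B G L *ℤ ideg G ⊤F Y                                      ∎
      where
      open ≡-Reasoning
      A : List (Fin n)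
      A = atomsNotBelow G

  data StrictChain : Fin n → List (Fin n) → Set where
    []  : ∀ {B} → StrictChain B []
    _∷_ : ∀ {B G Gs} → B ⊏ G × G ≢ ⊤F → StrictChain G Gs → StrictChain B (G ∷ Gs)

  chainDeg : Fin n → List (Fin n) → Monomial → ℤ
  chainDeg B []       u = ideg B ⊤F u
  chainDeg B (G ∷ Gs) u = ideg B G (below G u) *ℤ chainDeg G Gs (notBelow G u)

  prodX-above : ∀ {G Gs} → StrictChain G Gs → Supported (G ⊏_) (prodP (map x Gs))
  prodX-above []                 = [] ∷ []
  prodX-above {G} {G₁ ∷ Gs} ((G⊏G₁ , _) ∷ ch) =
    *P-supported (x G₁) (prodP (map x Gs))
      (Supported-map (⊏-⊑-trans G⊏G₁) (x-supported G₁)) (Supported-map (⊏-trans G⊏G₁) (prodX-above ch))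

  lin-prodX : ∀ {B Gs} → StrictChain B Gs → ∀ u →
              lin (λ v → ideg B ⊤F (u ++ v)) (prodP (map x Gs)) ≡ chainDeg B Gs u
  lin-prodX {B} [] u = trans (lin-monomial (λ v → ideg B ⊤F (u ++ v)) []) (cong (ideg B ⊤F) (ListP.++-identityʳ u))
  lin-prodX {B} {G ∷ Gs} ((B⊏G , G≢⊤) ∷ ch) u = begin
    lin (λ v → ideg B ⊤F (u ++ v)) (x G *P Q)                                 ≡⟨ lin-*P _ (x G) Q ⟩
    lin (λ v → lin (λ w → ideg B ⊤F (u ++ (w ++ v))) (x G)) Q                 ≡⟨ lin-cong-supported (prodX-above ch) factor ⟩
    lin (λ v → ideg B G (below G u) *ℤ ideg G ⊤F (notBelow G u ++ v)) Q
      ≡⟨ lin-scale (ideg B G (below G u)) (λ v → ideg G ⊤F (notBelow G u ++ v)) Q ⟩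
    ideg B G (below G u) *ℤ lin (λ v → ideg G ⊤F (notBelow G u ++ v)) Q       ≡⟨ cong (ideg B G (below G u) *ℤ_) (lin-prodX ch (notBelow G u)) ⟩
    chainDeg B (G ∷ Gs) u                                                      ∎
    where
    open ≡-Reasoning
    Q : Poly
    Q = prodP (map x Gs)
    factor : ∀ {v} → All (G ⊏_) v →
             lin (λ w → ideg B ⊤F (u ++ (w ++ v))) (x G) ≡ ideg B G (below G u) *ℤ ideg G ⊤F (notBelow G u ++ v)
    factor {v} v-above = begin
      lin (λ w → ideg B ⊤F (u ++ (w ++ v))) (x G)
        ≡⟨ ∑-cong (x G) (λ {(c , w)} _ → cong (c *ℤ_) (ideg-↭ B ⊤F (shifts u w))) ⟩
      lin (λ w → ideg B ⊤F (w ++ (u ++ v))) (x G)                        ≡⟨ Factorisation.lin-x B⊏G (u ++ v) G≢⊤ ⟩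
      ideg B G (below G (u ++ v)) *ℤ ideg G ⊤F (notBelow G (u ++ v))     ≡⟨ cong₂ (λ l y → ideg B G l *ℤ ideg G ⊤F y) below-++ notBelow-++ ⟩
      ideg B G (below G u) *ℤ ideg G ⊤F (notBelow G u ++ v)              ∎
      where
      v⋢G : All (λ y → ¬ y ⊑ G) v
      v⋢G = All.map (λ (G⊑y , G≢y) y⊑G → G≢y (antisym G⊑y y⊑G)) v-above
      below-++ : below G (u ++ v) ≡ below G u
      below-++ = trans (ListP.filter-++ (_⊑? G) u v)
                       (trans (cong (below G u ++_) (ListP.filter-none (_⊑? G) v⋢G)) (ListP.++-identityʳ _))
      notBelow-++ : notBelow G (u ++ v) ≡ notBelow G u ++ v
      notBelow-++ = trans (ListP.filter-++ (¬? ∘ (_⊑? G)) u v) (cong (notBelow G u ++_) (ListP.filter-all (¬? ∘ (_⊑? G)) v⋢G))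

  -- toPoly m is definitionally (1ℤ , flat m) ∷ [].
  flat : SMono → Monomial
  flat = concatMap (λ (F , a) → replicate a F)

  ∈-flat⁻ : ∀ {y} m → y ∈ flat m → ∃[ a ] (y , a) ∈ m
  ∈-flat⁻ ((F , a) ∷ m) y∈ with ∈P.∈-++⁻ (replicate a F) y∈
  ... | inj₁ y∈Fᵃ = a , here (cong (_, a) (All.lookup (AllP.replicate⁺ {P = _≡ F} a refl) y∈Fᵃ))
  ... | inj₂ y∈m  = Product.map₂ there (∈-flat⁻ m y∈m)

  profile : SMono → Profile
  profile = map (λ (F , a) → rk F , a)

  standardFrom-profile : ∀ {B m} → ChainFrom B m → StandardFrom (rk B) (profile m)
  standardFrom-profile []                           = []
  standardFrom-profile ((B⊏F , 0<a , a<rkF∸rkB) ∷ ch) =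
    (0<a , ℕP.m≤o∸n⇒m+n≤o (suc _) (ℕP.<⇒≤ (rk-strict B⊏F)) a<rkF∸rkB) ∷ standardFrom-profile ch

  length-filter-flat : ∀ {P : Pred (Fin n) 0ℓ} (P? : Decidable P) k m →
                       All (λ (F , _) → (P F → rk F ≤ k) × (rk F ≤ k → P F)) m →
                       length (filter P? (flat m)) ≡ weight≤ k (profile m)
  length-filter-flat P? k []            []                  = refl
  length-filter-flat P? k ((F , a) ∷ m) ((P⇒≤ , ≤⇒P) ∷ rest) =
    trans (length-filter-++ P? (replicate a F) (flat m)) (cong₂ _+_ head (length-filter-flat P? k m rest))
    where
    head : length (filter P? (replicate a F)) ≡ (if ⌊ rk F ℕ.≤? k ⌋ then a else 0)
    head with rk F ℕ.≤? k
    ... | yes ≤k = length-filter-replicate P? a (≤⇒P ≤k)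
    ... | no  ≰k = length-filter-replicate-¬ P? a (≰k ∘ P⇒≤)

  chainFrom-above : ∀ {B m} → ChainFrom B m → All (λ (F , _) → B ⊏ F) m
  chainFrom-above []                 = []
  chainFrom-above ((B⊏F , _) ∷ ch) = B⊏F ∷ All.map (⊏-trans B⊏F) (chainFrom-above ch)

  flat-above : ∀ {B m} → ChainFrom B m → All (B ⊏_) (flat m)
  flat-above {m = m} ch = All.tabulate (λ y∈ → All.lookup (chainFrom-above ch) (proj₂ (∈-flat⁻ m y∈)))

  notBelow-flat : ∀ {B m} → ChainFrom B m → notBelow B (flat m) ≡ flat m
  notBelow-flat ch = ListP.filter-all (¬? ∘ (_⊑? _)) (All.map (λ (B⊑y , B≢y) y⊑B → B≢y (antisym B⊑y y⊑B)) (flat-above ch))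

  count-flat : ∀ {B m} → ChainFrom B m → count B (flat m) ≡ 0
  count-flat ch = cong length (ListP.filter-none (_⊑? _) (All.map (λ (B⊑y , B≢y) y⊑B → B≢y (antisym B⊑y y⊑B)) (flat-above ch)))

  count-flat-∷ : ∀ {F G} a m → F ⊑ G → count G (flat ((F , a) ∷ m)) ≡ a + count G (flat m)
  count-flat-∷ {F} {G} a m F⊑G =
    trans (length-filter-++ (_⊑? G) (replicate a F) (flat m)) (cong (_+ count G (flat m)) (length-filter-replicate (_⊑? G) a F⊑G))

  weight≤-head : ∀ {F a m} → ChainFrom F m → weight≤ (rk F) (profile ((F , a) ∷ m)) ≡ a
  weight≤-head {F} {a} {m} ch =
    trans (weight≤-∷-≤ a (profile m) ℕP.≤-refl)
          (trans (cong (a +_) (weight≤-below (standardFrom-profile ch) ℕP.≤-refl)) (ℕP.+-identityʳ a))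

  heads-agree : ∀ {B F F′ a a′ m m′} → ChainFrom B ((F , a) ∷ m) → ChainFrom B ((F′ , a′) ∷ m′) →
                count F (flat ((F′ , a′) ∷ m′)) ≡ a →
                (∀ k → 0 < k → k ≤ r → weight≤ k (profile ((F′ , a′) ∷ m′)) ≡ weight≤ k (profile ((F , a) ∷ m))) →
                F′ ≡ F × a′ ≡ a
  heads-agree {B} {F} {F′} {a} {a′} {m} {m′} ((_ , 0<a , _) ∷ rest) ((B⊏F′ , 0<a′ , _) ∷ rest′) countF weights =
    F′≡F , trans (sym count-a′) countF
    where
    rkF≤rkF′ : rk F ≤ rk F′
    rkF≤rkF′ = ℕP.≮⇒≥ λ rkF′<rkF → ℕP.<⇒≢ 0<a′ (sym (begin
      a′                                           ≡⟨ weight≤-head rest′ ⟨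
      weight≤ (rk F′) (profile ((F′ , a′) ∷ m′))   ≡⟨ weights (rk F′) (ℕP.≤-<-trans z≤n (rk-strict B⊏F′)) (rk≤r F′) ⟩
      weight≤ (rk F′) (profile ((F , a) ∷ m))      ≡⟨ weight≤-∷-> a (profile m) rkF′<rkF ⟩
      weight≤ (rk F′) (profile m)                  ≡⟨ weight≤-below (standardFrom-profile rest) (ℕP.<⇒≤ rkF′<rkF) ⟩
      0                                            ∎))
      where open ≡-Reasoning
    F′⊑F : F′ ⊑ F
    F′⊑F with ∃∈-filter (_⊑? F) (flat ((F′ , a′) ∷ m′)) (subst (0 <_) (sym countF) 0<a)
    ... | y , y∈ , y⊑F with ∈-flat⁻ ((F′ , a′) ∷ m′) y∈
    ...   | _ , here refl = y⊑F
    ...   | _ , there e∈  = ⊑-trans (proj₁ (All.lookup (chainFrom-above rest′) e∈)) y⊑F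
    F′≡F : F′ ≡ F
    F′≡F = rk-≤⇒≡ F′⊑F rkF≤rkF′
    count-a′ : count F (flat ((F′ , a′) ∷ m′)) ≡ a′
    count-a′ = trans (count-flat-∷ a′ m′ F′⊑F) (trans (cong (a′ +_) (count-flat (subst (λ G → ChainFrom G m′) F′≡F rest′)))
                                                       (ℕP.+-identityʳ a′))

  CountsMatch : SMono → SMono → Set
  CountsMatch m m′ = All (λ (F , _) → count F (flat m′) ≡ weight≤ (rk F) (profile m)) m

  standard-unique : ∀ {B m m′} → ChainFrom B m → ChainFrom B m′ → CountsMatch m m′ →
                    (∀ k → 0 < k → k ≤ r → weight≤ k (profile m′) ≡ weight≤ k (profile m)) → m′ ≡ m
  standard-unique [] [] _ _ = refl
  standard-unique [] ((B⊏F′ , 0<a′ , _) ∷ rest′) _ weights =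
    ⊥-elim (ℕP.<⇒≢ 0<a′ (sym (trans (sym (weight≤-head rest′)) (weights _ (ℕP.≤-<-trans z≤n (rk-strict B⊏F′)) (rk≤r _)))))
  standard-unique ((_ , 0<a , _) ∷ rest) [] (count≡ ∷ _) _ = ⊥-elim (ℕP.<⇒≢ 0<a (trans count≡ (weight≤-head rest)))
  standard-unique {m = (F , a) ∷ m} {(F′ , a′) ∷ m′} ch@(_ ∷ rest) ch′@(_ ∷ rest′) (count≡ ∷ counts) weights
    with heads-agree ch ch′ (trans count≡ (weight≤-head rest)) weights
  ... | refl , refl = cong ((F , a) ∷_) (standard-unique rest rest′ counts′ weights′)
    where
    counts′ : CountsMatch m m′
    counts′ = All.zipWith (λ (count≡G , F⊏G) → ℕP.+-cancelˡ-≡ a _ _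
                (trans (sym (count-flat-∷ a m′ (proj₁ F⊏G))) (trans count≡G (weight≤-∷-≤ a (profile m) (ℕP.<⇒≤ (rk-strict F⊏G))))))
                (counts , chainFrom-above rest)
    weights′ : ∀ k → 0 < k → k ≤ r → weight≤ k (profile m′) ≡ weight≤ k (profile m)
    weights′ k 0<k k≤r = ℕP.+-cancelˡ-≡ (if ⌊ rk F ℕ.≤? k ⌋ then a else 0) _ _ (weights k 0<k k≤r)

  counts⇒weight≤-≤ : ∀ {m m′} → Standard m → CountsMatch m m′ →
                          ∀ k → weight≤ k (profile m) ≤ weight≤ k (profile m′)
  counts⇒weight≤-≤ {m} {m′} std counts k with weight≤-attained (standardFrom-profile std) k
  ... | inj₁ w≡0 = subst (_≤ weight≤ k (profile m′)) (sym w≡0) z≤n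
  ... | inj₂ (e , e∈ , e≤k , w≡) with ∈P.∈-map⁻ (λ (F , a) → rk F , a) e∈
  ...   | (F , a) , e′∈ , refl = begin
    weight≤ k (profile m)                             ≡⟨ w≡ ⟩
    weight≤ (rk F) (profile m)                        ≡⟨ All.lookup counts e′∈ ⟨
    count F (flat m′)                                 ≤⟨ length-filter-mono (_⊑? F) (λ y → rk y ℕ.≤? k) (flat m′)
                                                           (λ _ y⊑F → ℕP.≤-trans (rk-mono y⊑F) e≤k) ⟩
    length (filter (λ y → rk y ℕ.≤? k) (flat m′))
      ≡⟨ length-filter-flat (λ y → rk y ℕ.≤? k) k m′ (All.universal (λ _ → (λ ≤k → ≤k) , (λ ≤k → ≤k)) m′) ⟩
    weight≤ k (profile m′)                            ∎
    where open ℕP.≤-Reasoning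

  δ≡ : ∀ m → δ m ≡ map (λ k → weight≤ k (profile m)) (map suc (upTo r))
  δ≡ m = ListP.map-cong (λ k → weight-sum k m) (map suc (upTo r))
    where
    weight-sum : ∀ k m → sumℕ (map (λ (F , a) → if ⌊ rk F ℕ.≤? k ⌋ then a else 0) m) ≡ weight≤ k (profile m)
    weight-sum k []      = refl
    weight-sum k (_ ∷ m) = cong (_ +_) (weight-sum k m)

  counts⇒≡⊎δ-< : ∀ {m m′} → Standard m → Standard m′ → CountsMatch m m′ →
                     m′ ≡ m ⊎ Lex-< _≡_ _<_ (δ m) (δ m′)
  counts⇒≡⊎δ-< {m} {m′} std std′ counts
    with map-≤⇒≡⊎Lex-< (λ k → weight≤ k (profile m)) (λ k → weight≤ k (profile m′))
                        (counts⇒weight≤-≤ {m′ = m′} std counts) (map suc (upTo r))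
  ... | inj₂ δ<δ′ = inj₂ (subst₂ (Lex-< _≡_ _<_) (sym (δ≡ m)) (sym (δ≡ m′)) δ<δ′)
  ... | inj₁ δ≡δ′ = inj₁ (standard-unique std std′ counts weights)
    where
    weights : ∀ k → 0 < k → k ≤ r → weight≤ k (profile m′) ≡ weight≤ k (profile m)
    weights (suc j) _ j<r = sym (map-≡⇒∈-≡ (λ k → weight≤ k (profile m)) (λ k → weight≤ k (profile m′)) δ≡δ′
                                   (∈P.∈-map⁺ suc (∈P.∈-upTo⁺ j<r)))

  module OnMaxChain {c : Fin (suc r) → Fin n} (maxChain : MaxChain c) where

    -- The maximal chain indexed by rank; the value beyond r is junk.
    chain : ℕ → Fin n
    chain k with k ℕ.<? suc r
    ... | yes k≤r = c (Fin.fromℕ< k≤r)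
    ... | no _    = ⊤F

    chain-fromℕ< : ∀ {k} (k≤r : k < suc r) → chain k ≡ c (Fin.fromℕ< k≤r)
    chain-fromℕ< {k} k≤r with k ℕ.<? suc r
    ... | yes _  = refl
    ... | no k≰r = ⊥-elim (k≰r k≤r)

    chain-toℕ : ∀ i → chain (toℕ i) ≡ c i
    chain-toℕ i = trans (chain-fromℕ< (FinP.toℕ<n i)) (cong c (FinP.fromℕ<-toℕ i (FinP.toℕ<n i)))

    chain-0 : chain 0 ≡ ⊥F
    chain-0 = trans (chain-fromℕ< (s≤s z≤n)) (proj₁ maxChain)

    chain-r : chain r ≡ ⊤F
    chain-r = trans (cong chain (sym (FinP.toℕ-fromℕ r))) (trans (chain-toℕ (Fin.fromℕ r)) (proj₁ (proj₂ maxChain)))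

    chain-covers : ∀ {k} → k < r → Covers _⊑_ (chain k) (chain (suc k))
    chain-covers {k} k<r = subst₂ (Covers _⊑_) (sym at-k) (sym at-k+1) (proj₂ (proj₂ maxChain) i)
      where
      i : Fin r
      i = Fin.fromℕ< k<r
      at-k : chain k ≡ c (Fin.inject₁ i)
      at-k = trans (cong chain (sym (trans (FinP.toℕ-inject₁ i) (FinP.toℕ-fromℕ< k<r)))) (chain-toℕ (Fin.inject₁ i))
      at-k+1 : chain (suc k) ≡ c (Fin.suc i)
      at-k+1 = trans (cong (chain ∘ suc) (sym (FinP.toℕ-fromℕ< k<r))) (chain-toℕ (Fin.suc i))

    rk-chain : ∀ {k} → k ≤ r → rk (chain k) ≡ k
    rk-chain {zero}  _   = trans (cong rk chain-0) rk⊥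
    rk-chain {suc k} k<r = trans (rk-satChain (step (chain-covers k<r) done))
                                 (trans (ℕP.+-comm _ 1) (cong suc (rk-chain (ℕP.<⇒≤ k<r))))

    chain-mono : ∀ {j k} → j ≤ k → k ≤ r → chain j ⊑ chain k
    chain-mono {j} {zero}  z≤n   _     = ⊑-refl
    chain-mono {j} {suc k} j≤k+1 k+1≤r with j ℕ.≟ suc k
    ... | yes refl = ⊑-refl
    ... | no j≢k+1 = ⊑-trans (chain-mono (ℕP.≤-pred (ℕP.≤∧≢⇒< j≤k+1 j≢k+1)) (ℕP.<⇒≤ k+1≤r))
                              (proj₁ (proj₁ (chain-covers k+1≤r)))

    chain-mono⁻ : ∀ {j k} → j ≤ r → k ≤ r → chain j ⊑ chain k → j ≤ k
    chain-mono⁻ j≤r k≤r j⊑k = subst₂ _≤_ (rk-chain j≤r) (rk-chain k≤r) (rk-mono j⊑k)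

    chain-strict : ∀ {j k} → j < k → k ≤ r → chain j ⊏ chain k
    chain-strict {j} {k} j<k k≤r =
      chain-mono (ℕP.<⇒≤ j<k) k≤r ,
      λ j≡k → ℕP.<⇒≢ j<k (trans (sym (rk-chain (ℕP.≤-trans (ℕP.<⇒≤ j<k) k≤r))) (trans (cong rk j≡k) (rk-chain k≤r)))

    chain≢⊤ : ∀ {k} → k < r → chain k ≢ ⊤F
    chain≢⊤ {k} k<r k≡⊤ = ℕP.<⇒≢ k<r (trans (sym (rk-chain (ℕP.<⇒≤ k<r))) (cong rk k≡⊤))

    walk⇒strictChain : ∀ {ps q₀ qs} → Walk ps r q₀ qs → StrictChain (chain q₀) (map chain qs)
    walk⇒strictChain (finish _ _)                  = []
    walk⇒strictChain ((q₀<q , _ , q<r , _) ∷ w) = (chain-strict q₀<q (ℕP.<⇒≤ q<r) , chain≢⊤ q<r) ∷ walk⇒strictChain w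

    OnChain : SMono → Set
    OnChain m = All (λ (F , _) → F ≡ chain (rk F)) m

    extends⇒onChain : ∀ {m} → Extends c m → OnChain m
    extends⇒onChain ext = All.map (λ {e} → on-chain {e}) ext
      where
      on-chain : ∀ {e : Fin n × ℕ} → ∃[ i ] c i ≡ proj₁ e → proj₁ e ≡ chain (rk (proj₁ e))
      on-chain (i , cᵢ≡F) =
        let F≡ = trans (sym cᵢ≡F) (sym (chain-toℕ i))
        in trans F≡ (cong chain (sym (trans (cong rk F≡) (rk-chain (ℕP.≤-pred (FinP.toℕ<n i))))))

    count-chain-flat : ∀ {q} m → OnChain m → q ≤ r → count (chain q) (flat m) ≡ weight≤ q (profile m)
    count-chain-flat {q} m onChain q≤r = length-filter-flat (_⊑? chain q) q m (All.map (λ {e} → bounds {e}) onChain)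
      where
      bounds : ∀ {e : Fin n × ℕ} → proj₁ e ≡ chain (rk (proj₁ e)) →
               (proj₁ e ⊑ chain q → rk (proj₁ e) ≤ q) × (rk (proj₁ e) ≤ q → proj₁ e ⊑ chain q)
      bounds {F , _} F≡ = (λ F⊑ → chain-mono⁻ (rk≤r F) q≤r (subst (_⊑ chain q) F≡ F⊑))
                        , (λ f≤q → subst (_⊑ chain q) (sym F≡) (chain-mono f≤q q≤r))

    module OnStandard {m : SMono} (std : Standard m) (onChain : OnChain m) where

      ps : Profile
      ps = profile m

      standard : StandardFrom 0 ps
      standard = subst (λ b → StandardFrom b ps) rk⊥ (standardFrom-profile std)

      ¬removed-r : ¬ Removed ps r
      ¬removed-r = not-removed-above (AllP.map⁺ (All.universal (λ (F , _) → rk≤r F) m))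

      Gap : ℕ → ℕ → Set
      Gap q₀ q = q₀ < q × q ≤ r × ¬ Removed ps q₀ × ¬ Removed ps q × RemovedBetween ps q₀ q

      gap-count : ∀ {q₀ q} → Gap q₀ q → ∀ u → count (chain q₀) u ≡ weight≤ q₀ ps →
                  suc (rk (chain q₀) + length (below (chain q) (notBelow (chain q₀) u))) ≡ rk (chain q)
                    ⇔ count (chain q) u ≡ weight≤ q ps
      gap-count {q₀} {q} (q₀<q , q≤r , ¬rem₀ , ¬rem , between) u count₀ =
        subst₂ (λ a b → suc (a + ℓ) ≡ b ⇔ count (chain q) u ≡ weight≤ q ps) (sym (rk-chain q₀≤r)) (sym (rk-chain q≤r))
          (subst (λ c → suc (q₀ + ℓ) ≡ q ⇔ c ≡ weight≤ q ps) (sym count≡)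
            (gap-arith (weight≤-gap standard z≤n q₀<q ¬rem₀ ¬rem between)))
        where
        q₀≤r : q₀ ≤ r
        q₀≤r = ℕP.≤-trans (ℕP.<⇒≤ q₀<q) q≤r
        ℓ : ℕ
        ℓ = length (below (chain q) (notBelow (chain q₀) u))
        count≡ : count (chain q) u ≡ weight≤ q₀ ps + ℓ
        count≡ = trans (count-interval u (chain-mono (ℕP.<⇒≤ q₀<q) q≤r)) (cong (_+ ℓ) count₀)

      gap-degOne : ∀ {q₀ q} → Gap q₀ q → DegOne (chain q₀) (chain q) (below (chain q) (notBelow (chain q₀) (flat m)))
      gap-degOne {q₀} {q} gap@(q₀<q , q≤r , _ , _ , between) = size , hall
        where
        q₀≤r : q₀ ≤ r
        q₀≤r = ℕP.≤-trans (ℕP.<⇒≤ q₀<q) q≤r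
        L : Monomial
        L = below (chain q) (notBelow (chain q₀) (flat m))
        size : suc (rk (chain q₀) + length L) ≡ rk (chain q)
        size = Equivalence.from (gap-count gap (flat m) (count-chain-flat m onChain q₀≤r)) (count-chain-flat m onChain q≤r)
        top : ∀ {y} → y ∈ L → y ≡ chain q
        top {y} y∈L =
          let y∈ , y⊑q    = ∈P.∈-filter⁻ (_⊑? chain q) {xs = notBelow (chain q₀) (flat m)} y∈L
              y∈m , y⋢q₀  = ∈P.∈-filter⁻ (¬? ∘ (_⊑? chain q₀)) {xs = flat m} y∈
              a , e∈      = ∈-flat⁻ m y∈m
              y≡          = All.lookup onChain e∈
              f≤q         = chain-mono⁻ (rk≤r y) q≤r (subst (_⊑ chain q) y≡ y⊑q)
              q₀<f        = ℕP.≰⇒> (λ f≤q₀ → y⋢q₀ (subst (_⊑ chain q₀) (sym y≡) (chain-mono f≤q₀ q₀≤r)))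
          in trans y≡ (cong chain (rank-in-gap standard (∈P.∈-map⁺ (λ (F , a) → rk F , a) e∈) q₀<f f≤q between))
        hall : Hall (chain q₀) L
        hall X 0<cX = begin-strict
          rk (chain q₀) + count X L    ≤⟨ ℕP.+-monoʳ-≤ (rk (chain q₀)) (ListP.length-filter (_⊑? X) L) ⟩
          rk (chain q₀) + length L     <⟨ ℕP.≤-reflexive size ⟩
          rk (chain q)                 ≤⟨ rk-mono (⊑-trans (subst (_⊑ X) (top y∈L) y⊑X) (y≤x∨y (chain q₀) X)) ⟩
          rk (chain q₀ ∨ X)            ∎
          where
          open ℕP.≤-Reasoning
          witness = ∃∈-filter (_⊑? X) L 0<cX
          y = proj₁ witness
          y∈L = proj₁ (proj₂ witness)
          y⊑X = proj₂ (proj₂ witness)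

      degOne-at-top : ∀ {B} u → DegOne B (chain r) (below (chain r) u) → DegOne B ⊤F u
      degOne-at-top {B} u = subst (DegOne B ⊤F) (below-⊤ u) ∘ subst (λ T → DegOne B T (below T u)) chain-r

      degOne-from-top : ∀ {B} u → DegOne B ⊤F u → DegOne B (chain r) (below (chain r) u)
      degOne-from-top {B} u = subst (λ T → DegOne B T (below T u)) (sym chain-r) ∘ subst (DegOne B ⊤F) (sym (below-⊤ u))

      chainDeg-self : ∀ {q₀ qs} → Walk ps r q₀ qs → ¬ Removed ps q₀ →
                      chainDeg (chain q₀) (map chain qs) (notBelow (chain q₀) (flat m)) ≡ 1ℤ
      chainDeg-self {q₀} (finish q₀<r between) ¬rem₀ =
        indicator-yes (degOne? (chain q₀) ⊤F (notBelow (chain q₀) (flat m)))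
          (degOne-at-top (notBelow (chain q₀) (flat m)) (gap-degOne (q₀<r , ℕP.≤-refl , ¬rem₀ , ¬removed-r , between)))
      chainDeg-self {q₀} {q ∷ qs} ((q₀<q , ¬rem , q<r , between) ∷ w) ¬rem₀ = begin
        ideg (chain q₀) (chain q) (below (chain q) v) *ℤ chainDeg (chain q) (map chain qs) (notBelow (chain q) v)
          ≡⟨ cong₂ _*ℤ_
               (indicator-yes (degOne? (chain q₀) (chain q) (below (chain q) v))
                 (gap-degOne (q₀<q , ℕP.<⇒≤ q<r , ¬rem₀ , ¬rem , between)))
               (cong (chainDeg (chain q) (map chain qs))
                 (notBelow-notBelow (flat m) (chain-mono (ℕP.<⇒≤ q₀<q) (ℕP.<⇒≤ q<r)))) ⟩
        1ℤ *ℤ chainDeg (chain q) (map chain qs) (notBelow (chain q) (flat m))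
          ≡⟨ ℤP.*-identityˡ _ ⟩
        chainDeg (chain q) (map chain qs) (notBelow (chain q) (flat m))
          ≡⟨ chainDeg-self w ¬rem ⟩
        1ℤ ∎
        where
        open ≡-Reasoning
        v : Monomial
        v = notBelow (chain q₀) (flat m)

      chainDeg≢0⇒counts : ∀ {q₀ qs} u → Walk ps r q₀ qs → ¬ Removed ps q₀ → count (chain q₀) u ≡ weight≤ q₀ ps →
                             chainDeg (chain q₀) (map chain qs) (notBelow (chain q₀) u) ≢ 0ℤ →
                             All (λ q → count (chain q) u ≡ weight≤ q ps) qs × count (chain r) u ≡ weight≤ r ps
      chainDeg≢0⇒counts {q₀} u (finish q₀<r between) ¬rem₀ count₀ ≢0 =
        [] , Equivalence.to (gap-count (q₀<r , ℕP.≤-refl , ¬rem₀ , ¬removed-r , between) u count₀)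
               (proj₁ (degOne-from-top (notBelow (chain q₀) u)
                        (indicator≢0 (degOne? (chain q₀) ⊤F (notBelow (chain q₀) u)) ≢0)))
      chainDeg≢0⇒counts {q₀} {q ∷ qs} u ((q₀<q , ¬rem , q<r , between) ∷ w) ¬rem₀ count₀ ≢0 =
        let ideg≢0 , rest≢0 = *≢0⇒≢0 ≢0
            count-q = Equivalence.to (gap-count (q₀<q , ℕP.<⇒≤ q<r , ¬rem₀ , ¬rem , between) u count₀)
                        (proj₁ (indicator≢0 (degOne? (chain q₀) (chain q) (below (chain q) (notBelow (chain q₀) u))) ideg≢0))
            rest≢0′ = rest≢0 ∘ trans (cong (chainDeg (chain q) (map chain qs))
                        (notBelow-notBelow u (chain-mono (ℕP.<⇒≤ q₀<q) (ℕP.<⇒≤ q<r))))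
            counts , count-r = chainDeg≢0⇒counts u w ¬rem count-q rest≢0′
        in count-q ∷ counts , count-r

      removed⇒ : ∀ {i} → Removed ps i → Any (λ (F , a) → rk F ∸ a ≤ i × i < rk F) m
      removed⇒ rem = Any.map (λ (f≤a+i , i<f) → ℕP.m≤n+o⇒m∸n≤o _ _ f≤a+i , i<f) (AnyP.map⁻ rem)

      removed⇐ : ∀ {i} → Any (λ (F , a) → rk F ∸ a ≤ i × i < rk F) m → Removed ps i
      removed⇐ rem = AnyP.map⁺ (Any.map (λ {(F , a)} (f∸a≤i , i<f) →
                       ℕP.≤-trans (ℕP.m≤n+m∸n (rk F) a) (ℕP.+-monoʳ-≤ a f∸a≤i) , i<f) rem)

      Essential? : (i : Fin (suc r)) → Dec (¬ Any (λ (F , a) → rk F ∸ a ≤ toℕ i × toℕ i < rk F) m × c i ≢ ⊤F × c i ≢ ⊥F)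
      Essential? i = ¬? (removed? m (toℕ i)) ×-dec (¬? (c i ≟F ⊤F) ×-dec ¬? (c i ≟F ⊥F))

      essentialIndices : List (Fin (suc r))
      essentialIndices = filter Essential? (allFin (suc r))

      essentialPositions : List ℕ
      essentialPositions = map toℕ essentialIndices

      essentialNonempty≡ : essentialNonempty m c ≡ map chain essentialPositions
      essentialNonempty≡ = trans (ListP.map-cong (sym ∘ chain-toℕ) essentialIndices) (ListP.map-∘ essentialIndices)

      essential⁻ : ∀ {p} → p ∈ essentialPositions → ¬ Removed ps p × p < r × 0 < p
      essential⁻ {p} p∈ =
        let i , i∈ , p≡i = ∈P.∈-map⁻ toℕ p∈
            _ , ¬rem , c≢⊤ , c≢⊥ = ∈P.∈-filter⁻ Essential?
                                     {xs = allFin (suc r)} i∈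
            cᵢ≡ : c i ≡ chain p
            cᵢ≡ = trans (sym (chain-toℕ i)) (cong chain (sym p≡i))
        in (λ rem → ¬rem (removed⇒ (subst (Removed ps) p≡i rem)))
         , ℕP.≤∧≢⇒< (subst (_≤ r) (sym p≡i) (ℕP.≤-pred (FinP.toℕ<n i))) (λ p≡r → c≢⊤ (trans cᵢ≡ (trans (cong chain p≡r) chain-r)))
         , ℕP.n≢0⇒n>0 (λ p≡0 → c≢⊥ (trans cᵢ≡ (trans (cong chain p≡0) chain-0)))

      essential⁺ : ∀ p → ¬ Removed ps p → 0 < p → p < r → p ∈ essentialPositions
      essential⁺ p ¬rem 0<p p<r =
        subst (_∈ essentialPositions) (FinP.toℕ-fromℕ< p<r+1)
          (∈P.∈-map⁺ toℕ (∈P.∈-filter⁺ Essential?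
            (∈P.∈-allFin i)
            ((¬rem ∘ removed⇐ ∘ subst (λ k → Any (λ (F , a) → rk F ∸ a ≤ k × k < rk F) m) (FinP.toℕ-fromℕ< p<r+1))
             , c≢⊤ , c≢⊥)))
        where
        p<r+1 : p < suc r
        p<r+1 = ℕP.m≤n⇒m≤1+n p<r
        i : Fin (suc r)
        i = Fin.fromℕ< p<r+1
        cᵢ≡ : c i ≡ chain p
        cᵢ≡ = sym (chain-fromℕ< p<r+1)
        c≢⊤ : c i ≢ ⊤F
        c≢⊤ = chain≢⊤ p<r ∘ trans (sym cᵢ≡)
        c≢⊥ : c i ≢ ⊥F
        c≢⊥ cᵢ≡⊥ = ℕP.<⇒≢ 0<p (sym (trans (sym (rk-chain (ℕP.<⇒≤ p<r))) (trans (cong rk (trans (sym cᵢ≡) cᵢ≡⊥)) rk⊥)))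

      essential-sorted : AllPairs _<_ essentialPositions
      essential-sorted = AllPairsP.map⁺ (AllPairsP.filter⁺ Essential? (AllPairsP.tabulate⁺-< (λ i<j → i<j)))

      essential-walk : 0 < r → Walk ps r 0 essentialPositions
      essential-walk 0<r =
        walk 0<r (All.tabulate (proj₂ ∘ proj₂ ∘ essential⁻)) essential-sorted
             (All.tabulate (Product.map₂ proj₁ ∘ essential⁻)) (λ p ¬rem 0<p p<r → essential⁺ p ¬rem 0<p p<r)

      module _ (0<r : 0 < r) where

        essentialChain : List (Fin n)
        essentialChain = map chain essentialPositions

        deg≡chainDeg : ∀ {m′} → Standard m′ →
                       deg (toPoly m′ *P xProd m c) ≡ chainDeg (chain 0) essentialChain (notBelow (chain 0) (flat m′))
        deg≡chainDeg {m′} std′ = begin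
          deg (toPoly m′ *P xProd m c)                                              ≡⟨ deg≡lin-ideg (toPoly m′ *P xProd m c) ⟩
          lin (ideg ⊥F ⊤F) (toPoly m′ *P xProd m c)                                 ≡⟨ lin-*P (ideg ⊥F ⊤F) (toPoly m′) (xProd m c) ⟩
          lin (λ v → lin (λ w → ideg ⊥F ⊤F (w ++ v)) (toPoly m′)) (xProd m c)
            ≡⟨ lin-cong (xProd m c) (λ v → lin-monomial (λ w → ideg ⊥F ⊤F (w ++ v)) (flat m′)) ⟩
          lin (λ v → ideg ⊥F ⊤F (flat m′ ++ v)) (xProd m c)
            ≡⟨ cong (λ Gs → lin (λ v → ideg ⊥F ⊤F (flat m′ ++ v)) (prodP (map x Gs))) essentialNonempty≡ ⟩
          lin (λ v → ideg ⊥F ⊤F (flat m′ ++ v)) (prodP (map x essentialChain))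
            ≡⟨ lin-prodX (subst (λ B → StrictChain B essentialChain) chain-0 (walk⇒strictChain (essential-walk 0<r))) (flat m′) ⟩
          chainDeg ⊥F essentialChain (flat m′)
            ≡⟨ cong₂ (λ B v → chainDeg B essentialChain v) (sym chain-0)
                     (trans (sym (notBelow-flat std′)) (cong (λ B → notBelow B (flat m′)) (sym chain-0))) ⟩
          chainDeg (chain 0) essentialChain (notBelow (chain 0) (flat m′)) ∎
          where open ≡-Reasoning

        deg-self : deg (toPoly m *P xProd m c) ≡ 1ℤ
        deg-self = trans (deg≡chainDeg std) (chainDeg-self (essential-walk 0<r) (not-removed-below standard z≤n))

        deg≢0⇒counts : ∀ {m′} → Standard m′ → deg (toPoly m′ *P xProd m c) ≢ 0ℤ → CountsMatch m m′
        deg≢0⇒counts {m′} std′ deg≢0 = All.tabulate entry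
          where
          count₀ : count (chain 0) (flat m′) ≡ weight≤ 0 ps
          count₀ = trans (cong (λ B → count B (flat m′)) chain-0)
                         (trans (count-flat std′) (sym (weight≤-below standard z≤n)))
          counts = chainDeg≢0⇒counts (flat m′) (essential-walk 0<r) (not-removed-below standard z≤n) count₀
                     (deg≢0 ∘ trans (deg≡chainDeg std′))
          count-at : ∀ {f} → ¬ Removed ps f → 0 < f → f ≤ r → count (chain f) (flat m′) ≡ weight≤ f ps
          count-at {f} ¬rem 0<f f≤r with f ℕ.<? r
          ... | yes f<r = All.lookup (proj₁ counts) (essential⁺ f ¬rem 0<f f<r)
          ... | no  f≮r = subst (λ k → count (chain k) (flat m′) ≡ weight≤ k ps)
                                (ℕP.≤-antisym (ℕP.≮⇒≥ f≮r) f≤r) (proj₂ counts)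
          entry : ∀ {e} → e ∈ m → count (proj₁ e) (flat m′) ≡ weight≤ (rk (proj₁ e)) ps
          entry {F , a} e∈ =
            let e∈ps = ∈P.∈-map⁺ (λ (F , a) → rk F , a) e∈
            in trans (cong (λ B → count B (flat m′)) (All.lookup onChain e∈))
                     (count-at (rank-not-removed standard e∈ps) (All.lookup (ranks-above standard) e∈ps) (rk≤r F))

proposition2p17 : (M : Matroid) → 1 ≤ MatroidDefs.r M →
    (m : MatroidDefs.SMono M) → MatroidDefs.Standard M m →
    (c : Fin (Data.Nat.suc (MatroidDefs.r M)) → Fin (Matroid.n M)) →
    MatroidDefs.MaxChain M c → MatroidDefs.Extends M c m →
    (MatroidDefs.deg M (MatroidDefs._*P_ M (MatroidDefs.toPoly M m) (MatroidDefs.xProd M m c)) ≡ 1ℤ)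
    × (∀ (m′ : MatroidDefs.SMono M) → MatroidDefs.Standard M m′ →
         MatroidDefs.deg M (MatroidDefs._*P_ M (MatroidDefs.toPoly M m′) (MatroidDefs.xProd M m c)) ≢ 0ℤ →
         (m′ ≡ m) ⊎ Lex-< _≡_ _<_ (MatroidDefs.δ M m) (MatroidDefs.δ M m′))
proposition2p17 M 0<r m std c maxChain extends =
  deg-self 0<r , λ m′ std′ deg≢0 → counts⇒≡⊎δ-< M std std′ (deg≢0⇒counts 0<r std′ deg≢0)
  where
  open OnMaxChain M {c} maxChain
  open OnStandard std (extends⇒onChain extends)
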